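{- Let $k\ge2$ and consider the wheel $\mathcal{W}_{2k}$, with hub $u$ (the vertex of degree $2k$) and cycle vertices, in consecutive order around the cycle, $v_1,\dots,v_k,w_k,w_{k-1},\dots,w_1$ (so $w_1$ is adjacent to $v_1$). For $i=1,\dots,k$ put $r_i=s_i=\sum_{j=i}^{k} j$, and put $a=2\sum_{i=1}^k s_i=k(k+1)(2k+1)/3$. Let $R$ be the vector with entry $1$ at $u$, $r_i$ at $v_i$ and $s_i$ at $w_i$, and let $M=\mathrm{Diag}(\cdot)-A_{\mathcal{W}_{2k}}$ with diagonal entry $a$ at $u$, $3$ at $v_k$ and at $w_k$, and $2$ at all other vertices. Then $(M,R)$ is an arithmetical structure on $\mathcal{W}_{2k}$ whose associated group $\Phi_M$ is cyclic of order $6k-1$.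
   Context: The wheel $\mathcal{W}_n$ is the graph obtained from the cycle on $n$ vertices by adding a new vertex (hub) joined by one edge to each cycle vertex; $A_G$ denotes the adjacency matrix. An arithmetical structure on a graph $G$ with vertices $v_1,\dots,v_m$ is a pair $(M,R)$ with $M=\mathrm{Diag}(a_1,\dots,a_m)-A_G$ for integers $a_i\ge1$ and $R$ a column vector of positive integers with $\gcd$ of entries $1$ such that $MR=0$; its associated group $\Phi_M$ is the torsion subgroup of $\mathbb{Z}^m/\mathrm{Im}(M)$. -}

module Defs where

open import Data.Nat as ℕ using (ℕ; zero; suc; _≡ᵇ_; _<ᵇ_; _∸_)
open import Data.Nat.GCD using (gcd)
open import Data.Integer as ℤ using (ℤ; +_; _-_; _*_; _+_)
open import Data.Fin using (Fin; toℕ) renaming (zero to fzero; suc to fsuc)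
open import Data.Bool using (Bool; true; false; if_then_else_; _∨_; _∧_)
open import Data.List using (List; upTo; drop; map)
open import Data.Nat.ListAction using (sum)
open import Data.Product using (Σ; ∃; _×_)
open import Relation.Binary.PropositionalEquality using (_≡_)
open import Relation.Nullary using (¬_)

Vec' : ℕ → Set
Vec' m = Fin m → ℤ

Mat : ℕ → Set
Mat m = Fin m → Fin m → ℤ

sumFin : ∀ {m} → (Fin m → ℤ) → ℤ
sumFin {zero}  f = + 0
sumFin {suc m} f = f fzero + sumFin (λ i → f (fsuc i))

_·_ : ∀ {m} → Mat m → Vec' m → Vec' m
(M · x) i = sumFin (λ j → M i j * x j)

Diag : ∀ {m} → (Fin m → ℕ) → Mat m
Diag {suc m} a fzero    fzero    = + a fzero
Diag {suc m} a fzero    (fsuc j) = + 0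
Diag {suc m} a (fsuc i) fzero    = + 0
Diag {suc m} a (fsuc i) (fsuc j) = Diag (λ t → a (fsuc t)) i j

gcdVec : ∀ {m} → (Fin m → ℕ) → ℕ
gcdVec {zero}  f = 0
gcdVec {suc m} f = gcd (f fzero) (gcdVec (λ i → f (fsuc i)))

cycAdjᵇ : (n i j : ℕ) → Bool
cycAdjᵇ n i j = (j ≡ᵇ suc i) ∨ (i ≡ᵇ suc j)
              ∨ ((i ≡ᵇ 0) ∧ (j ≡ᵇ (n ∸ 1))) ∨ ((j ≡ᵇ 0) ∧ (i ≡ᵇ (n ∸ 1)))

-- Adjacency matrix of the wheel W_n: vertex fzero is the hub,
-- vertex fsuc p is the p-th cycle vertex (p = 0..n-1 in cyclic order)
wheelAdj : (n : ℕ) → Mat (suc n)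
wheelAdj n fzero    fzero    = + 0
wheelAdj n fzero    (fsuc j) = + 1
wheelAdj n (fsuc i) fzero    = + 1
wheelAdj n (fsuc i) (fsuc j) = if cycAdjᵇ n (toℕ i) (toℕ j) then + 1 else + 0

IsArithmeticalStructure : ∀ {m} → Mat m → Mat m → (Fin m → ℕ) → Set
IsArithmeticalStructure {m} A M R =
  (Σ (Fin m → ℕ) λ a → (∀ i → 1 ℕ.≤ a i) × (∀ i j → M i j ≡ Diag a i j - A i j))
  × (∀ i → 0 ℕ.< R i)
  × gcdVec R ≡ 1
  × (∀ i → (M · (λ j → + R j)) i ≡ + 0)

InIm : ∀ {m} → Mat m → Vec' m → Set
InIm {m} M x = Σ (Vec' m) λ z → ∀ i → x i ≡ (M · z) i

_≈[_]_ : ∀ {m} → Vec' m → Mat m → Vec' m → Set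
x ≈[ M ] y = InIm M (λ i → x i - y i)

scale : ∀ {m} → ℤ → Vec' m → Vec' m
scale c x i = c * x i

IsTorsion : ∀ {m} → Mat m → Vec' m → Set
IsTorsion M x = Σ ℕ λ n → (1 ℕ.≤ n) × InIm M (scale (+ n) x)

PhiCyclicOfOrder : ∀ {m} → Mat m → ℕ → Set
PhiCyclicOfOrder {m} M N =
  Σ (Vec' m) λ g →
      IsTorsion M g
    × InIm M (scale (+ N) g)
    × (∀ j → 1 ℕ.≤ j → j ℕ.< N → ¬ InIm M (scale (+ j) g))
    × (∀ t → IsTorsion M t → Σ ℤ λ c → t ≈[ M ] scale c g)

-- s_i = sum_{j=i}^{k} j   (list [i..k] = drop i [0..k])
sIdx : (k i : ℕ) → ℕ
sIdx k i = sum (drop i (upTo (suc k)))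

aHub : ℕ → ℕ
aHub k = 2 ℕ.* sum (map (sIdx k) (drop 1 (upTo (suc k))))

-- cycle position p (0-based, 0..2k-1) carries v_{p+1} for p < k and w_{2k-p} for p ≥ k;
-- cycIndex returns the subscript i of v_i / w_i
cycIndex : (k p : ℕ) → ℕ
cycIndex k p = if p <ᵇ k then suc p else (k ℕ.+ k) ∸ p

diagW : (k : ℕ) → Fin (suc (k ℕ.+ k)) → ℕ
diagW k fzero    = aHub k
diagW k (fsuc p) = if cycIndex k (toℕ p) ≡ᵇ k then 3 else 2

MW : (k : ℕ) → Mat (suc (k ℕ.+ k))
MW k i j = Diag (diagW k) i j - wheelAdj (k ℕ.+ k) i j

RW : (k : ℕ) → Fin (suc (k ℕ.+ k)) → ℕ
RW k fzero    = 1
RW k (fsuc p) = sIdx k (cycIndex k (toℕ p))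

-- The vector R lies in the kernel of the symmetric matrix M, so pairing with R vanishes on
-- Im M and on every torsion class. Modulo Im M every vector is an integer combination of
-- e_u and e_{v₁}: the column of a cycle vertex expresses each cycle vertex through its two
-- predecessors and e_u, and an explicit c′ with M c′ = e_{v₁} + e_{w₁} - 2 s₁ e_u starts
-- this recursion. Pairing with R then shows that every torsion class is a multiple of
-- g = e_{v₁} - s₁ e_u. An explicit c with M c = (6k-1) g shows that (6k-1) g ∈ Im M, and
-- if j g = M z then j ⟨c, g⟩ = ⟨M c, z⟩ = (6k-1) ⟨g, z⟩; as ⟨c, g⟩ = 3k²+k-1 is prime to
-- 6k-1, this forces 6k-1 ∣ j.

module Submission where

open import Algebra.Properties.CommutativeSemigroup using (interchange)
open import Data.Bool using (Bool; true; false; T; if_then_else_; _∨_; _∧_)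
open import Data.Bool.Properties using (∧-zeroʳ; ∧-identityʳ; ∨-identityʳ)
open import Data.Empty using (⊥; ⊥-elim)
open import Data.Fin using (Fin; toℕ; fromℕ<) renaming (zero to fzero; suc to fsuc)
import Data.Fin.Properties as Finₚ
open import Data.List using ([]; _∷_; drop; map; applyUpTo)
open import Data.List.Properties using (map-id)
open import Data.Integer using (ℤ; +_; _+_; _*_; _-_; -_)
open import Data.Integer.Divisibility.Signed using (_∣_; divides; ∣⇒∣ᵤ; ∣-refl; ∣n⇒∣m*n; ∣m∣n⇒∣m+n)
import Data.Integer.Properties as ℤₚ
open import Data.Integer.Tactic.RingSolver using (solve-∀)
open import Data.Nat as ℕ using (ℕ; zero; suc; _≡ᵇ_; _<ᵇ_; _∸_; z≤n; s≤s; _<_; _≤_; z<s; s<s)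
open import Data.Nat.Divisibility using (>⇒∤)
open import Data.Nat.GCD using (gcd-zeroˡ)
open import Data.Nat.ListAction using (sum)
import Data.Nat.Properties as ℕₚ
open import Data.Product using (Σ; _,_; proj₁; proj₂; _×_)
open import Data.Sum using (inj₁; inj₂)
open import Function using (_∘_; id)
open import Relation.Binary.PropositionalEquality
open import Relation.Nullary using (¬_; yes; no)

open import Defs

open ≡-Reasoning

-- Finite sums and the Kronecker delta

sumFin-cong : ∀ {m} {f g : Fin m → ℤ} → (∀ i → f i ≡ g i) → sumFin f ≡ sumFin g
sumFin-cong {zero}  f≡g = refl
sumFin-cong {suc m} f≡g = cong₂ _+_ (f≡g fzero) (sumFin-cong (f≡g ∘ fsuc))

sumFin-+ : ∀ {m} (f g : Fin m → ℤ) → sumFin (λ i → f i + g i) ≡ sumFin f + sumFin g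
sumFin-+ {zero}  f g = refl
sumFin-+ {suc m} f g =
  trans (cong (_+_ (f fzero + g fzero)) (sumFin-+ (f ∘ fsuc) (g ∘ fsuc)))
        (interchange ℤₚ.+-commutativeSemigroup (f fzero) (g fzero) _ _)

sumFin-*ˡ : ∀ {m} c (f : Fin m → ℤ) → sumFin (λ i → c * f i) ≡ c * sumFin f
sumFin-*ˡ {zero}  c f = sym (ℤₚ.*-zeroʳ c)
sumFin-*ˡ {suc m} c f =
  trans (cong (_+_ (c * f fzero)) (sumFin-*ˡ c (f ∘ fsuc))) (sym (ℤₚ.*-distribˡ-+ c _ _))

sumFin-*ʳ : ∀ {m} c (f : Fin m → ℤ) → sumFin (λ i → f i * c) ≡ sumFin f * c
sumFin-*ʳ c f = begin
  sumFin (λ i → f i * c) ≡⟨ sumFin-cong (λ i → ℤₚ.*-comm (f i) c) ⟩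
  sumFin (λ i → c * f i) ≡⟨ sumFin-*ˡ c f ⟩
  c * sumFin f           ≡⟨ ℤₚ.*-comm c _ ⟩
  sumFin f * c           ∎

sumFin-zero : ∀ {m} → sumFin {m} (λ _ → + 0) ≡ + 0
sumFin-zero {zero}  = refl
sumFin-zero {suc m} = cong (_+_ (+ 0)) (sumFin-zero {m})

sumFin-swap : ∀ {m m′} (h : Fin m → Fin m′ → ℤ) →
              sumFin (λ i → sumFin (h i)) ≡ sumFin (λ j → sumFin (λ i → h i j))
sumFin-swap {zero} {m′} h = sym (sumFin-zero {m′})
sumFin-swap {suc m} h =
  trans (cong (_+_ (sumFin (h fzero))) (sumFin-swap (h ∘ fsuc))) (sym (sumFin-+ (h fzero) _))

δ : ∀ {m} → Fin m → Fin m → ℤ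
δ fzero    fzero    = + 1
δ fzero    (fsuc _) = + 0
δ (fsuc _) fzero    = + 0
δ (fsuc i) (fsuc j) = δ i j

δ-sym : ∀ {m} (i j : Fin m) → δ i j ≡ δ j i
δ-sym fzero    fzero    = refl
δ-sym fzero    (fsuc j) = refl
δ-sym (fsuc i) fzero    = refl
δ-sym (fsuc i) (fsuc j) = δ-sym i j

δ-sumʳ : ∀ {m} (f : Fin m → ℤ) j → sumFin (λ l → f l * δ j l) ≡ f j
δ-sumʳ {suc m} f fzero = begin
  f fzero * + 1 + sumFin (λ l → f (fsuc l) * + 0)
    ≡⟨ cong₂ _+_ (ℤₚ.*-identityʳ (f fzero))
                 (trans (sumFin-cong (ℤₚ.*-zeroʳ ∘ f ∘ fsuc)) (sumFin-zero {m})) ⟩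
  f fzero + + 0
    ≡⟨ ℤₚ.+-identityʳ _ ⟩
  f fzero ∎
δ-sumʳ f (fsuc j) =
  trans (cong₂ _+_ (ℤₚ.*-zeroʳ (f fzero)) (δ-sumʳ (f ∘ fsuc) j)) (ℤₚ.+-identityˡ _)

δ-expand : ∀ {m} (t : Vec' m) i → t i ≡ sumFin (λ j → t j * δ j i)
δ-expand t i = sym (trans (sumFin-cong (λ j → cong (t j *_) (δ-sym j i))) (δ-sumʳ t i))

Diag-δ : ∀ {m} (a : Fin m → ℕ) i j → Diag a i j ≡ + a i * δ i j
Diag-δ {suc m} a fzero    fzero    = sym (ℤₚ.*-identityʳ _)
Diag-δ {suc m} a fzero    (fsuc j) = sym (ℤₚ.*-zeroʳ (+ a fzero))
Diag-δ {suc m} a (fsuc i) fzero    = sym (ℤₚ.*-zeroʳ (+ a (fsuc i)))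
Diag-δ {suc m} a (fsuc i) (fsuc j) = Diag-δ (a ∘ fsuc) i j

Diag-sym : ∀ {m} (a : Fin m → ℕ) i j → Diag a i j ≡ Diag a j i
Diag-sym {suc m} a fzero    fzero    = refl
Diag-sym {suc m} a fzero    (fsuc j) = refl
Diag-sym {suc m} a (fsuc i) fzero    = refl
Diag-sym {suc m} a (fsuc i) (fsuc j) = Diag-sym (a ∘ fsuc) i j

dot : ∀ {m} → Vec' m → Vec' m → ℤ
dot u v = sumFin (λ i → u i * v i)

dot-scaleʳ : ∀ {m} (u v : Vec' m) c → dot u (scale c v) ≡ c * dot u v
dot-scaleʳ u v c =
  trans (sumFin-cong (λ i → x*[y*z]≡y*[x*z] (u i) c (v i))) (sumFin-*ˡ c (λ i → u i * v i))
  where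
  x*[y*z]≡y*[x*z] : ∀ x y z → x * (y * z) ≡ y * (x * z)
  x*[y*z]≡y*[x*z] = solve-∀

dot-affine : ∀ {m} (u x y h : Vec' m) a b →
             dot u (λ i → x i - (a * y i + b * h i)) ≡ dot u x - (a * dot u y + b * dot u h)
dot-affine {m} u x y h a b = begin
  dot u (λ i → x i - (a * y i + b * h i))
    ≡⟨ sumFin-cong (λ i → expand a b (u i) (x i) (y i) (h i)) ⟩
  sumFin (λ i → u i * x i + (- a * (u i * y i) + - b * (u i * h i)))
    ≡⟨ sumFin-+ {m} _ _ ⟩
  dot u x + sumFin (λ i → - a * (u i * y i) + - b * (u i * h i))
    ≡⟨ cong (_+_ (dot u x))
            (trans (sumFin-+ {m} _ _) (cong₂ _+_ (sumFin-*ˡ {m} (- a) _) (sumFin-*ˡ {m} (- b) _))) ⟩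
  dot u x + (- a * dot u y + - b * dot u h)
    ≡⟨ collect a b (dot u x) (dot u y) (dot u h) ⟩
  dot u x - (a * dot u y + b * dot u h) ∎
  where
  expand : ∀ a b u x y h → u * (x - (a * y + b * h)) ≡ u * x + (- a * (u * y) + - b * (u * h))
  expand = solve-∀
  collect : ∀ a b x y h → x + (- a * y + - b * h) ≡ x - (a * y + b * h)
  collect = solve-∀

IsSymmetric : ∀ {m} → Mat m → Set
IsSymmetric M = ∀ i j → M i j ≡ M j i

·-selfAdjoint : ∀ {m} {M : Mat m} → IsSymmetric M → ∀ c z → dot c (M · z) ≡ dot (M · c) z
·-selfAdjoint {m} {M} M-sym c z = begin
  sumFin (λ i → c i * sumFin (λ j → M i j * z j))
    ≡⟨ sumFin-cong {m} (λ i → sym (sumFin-*ˡ {m} (c i) _)) ⟩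
  sumFin (λ i → sumFin (λ j → c i * (M i j * z j)))
    ≡⟨ sumFin-swap {m} {m} _ ⟩
  sumFin (λ j → sumFin (λ i → c i * (M i j * z j)))
    ≡⟨ sumFin-cong (λ j → sumFin-cong (λ i →
         trans (cong (λ x → c i * (x * z j)) (M-sym i j)) (reorder (c i) (M j i) (z j)))) ⟩
  sumFin (λ j → sumFin (λ i → M j i * c i * z j))
    ≡⟨ sumFin-cong (λ j → sumFin-*ʳ {m} (z j) _) ⟩
  dot (M · c) z ∎
  where
  reorder : ∀ x y w → x * (y * w) ≡ y * x * w
  reorder = solve-∀

·-linear : ∀ {m} (M : Mat m) a b (u v : Vec' m) i →
           (M · (λ j → a * u j + b * v j)) i ≡ a * (M · u) i + b * (M · v) i
·-linear {m} M a b u v i = begin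
  sumFin (λ j → M i j * (a * u j + b * v j))
    ≡⟨ sumFin-cong (λ j → distribute a b (M i j) (u j) (v j)) ⟩
  sumFin (λ j → a * (M i j * u j) + b * (M i j * v j))
    ≡⟨ sumFin-+ {m} _ _ ⟩
  sumFin (λ j → a * (M i j * u j)) + sumFin (λ j → b * (M i j * v j))
    ≡⟨ cong₂ _+_ (sumFin-*ˡ a (λ j → M i j * u j)) (sumFin-*ˡ b (λ j → M i j * v j)) ⟩
  a * (M · u) i + b * (M · v) i ∎
  where
  distribute : ∀ a b x u v → x * (a * u + b * v) ≡ a * (x * u) + b * (x * v)
  distribute = solve-∀

-- The cokernel of a symmetric integer matrix

module Image {m} (M : Mat m) where

  InIm-resp : ∀ {x y : Vec' m} → (∀ i → x i ≡ y i) → InIm M x → InIm M y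
  InIm-resp x≡y (z , x≡Mz) = z , λ i → trans (sym (x≡y i)) (x≡Mz i)

  InIm-zero : InIm M (λ _ → + 0)
  InIm-zero = (λ _ → + 0) , λ i → sym (trans (sumFin-cong (λ j → ℤₚ.*-zeroʳ (M i j))) (sumFin-zero {m}))

  InIm-lin : ∀ {x y : Vec' m} → InIm M x → InIm M y → ∀ a b → InIm M (λ i → a * x i + b * y i)
  InIm-lin (zx , x≡) (zy , y≡) a b =
    (λ j → a * zx j + b * zy j) ,
    λ i → trans (cong₂ (λ s t → a * s + b * t) (x≡ i) (y≡ i)) (sym (·-linear M a b zx zy i))

  InIm-column : ∀ j → InIm M (λ i → M i j)
  InIm-column j = δ j , λ i → sym (δ-sumʳ (M i) j)

InSpan : ∀ {m} → Mat m → Vec' m → Vec' m → Vec' m → Set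
InSpan M X H t = Σ ℤ λ a → Σ ℤ λ b → InIm M (λ i → t i - (a * X i + b * H i))

module Span {m} (M : Mat m) (X H : Vec' m) where

  open Image M

  InSpan-resp : ∀ {u v : Vec' m} → (∀ i → u i ≡ v i) → InSpan M X H u → InSpan M X H v
  InSpan-resp u≡v (a , b , u∈) =
    a , b , InIm-resp (λ i → cong (_- (a * X i + b * H i)) (u≡v i)) u∈

  InSpan-Im : ∀ {t : Vec' m} → InIm M t → InSpan M X H t
  InSpan-Im {t} t∈ = + 0 , + 0 , InIm-resp (λ i → x≡x-0 (t i) (X i) (H i)) t∈
    where
    x≡x-0 : ∀ t x h → t ≡ t - (+ 0 * x + + 0 * h)
    x≡x-0 = solve-∀

  InSpan-lin : ∀ {u v : Vec' m} → InSpan M X H u → InSpan M X H v →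
               ∀ a b → InSpan M X H (λ i → a * u i + b * v i)
  InSpan-lin {u} {v} (a₁ , b₁ , u∈) (a₂ , b₂ , v∈) a b =
    a * a₁ + b * a₂ , a * b₁ + b * b₂ ,
    InIm-resp (λ i → regroup a b a₁ b₁ a₂ b₂ (u i) (v i) (X i) (H i)) (InIm-lin u∈ v∈ a b)
    where
    regroup : ∀ a b a₁ b₁ a₂ b₂ u v x h →
      a * (u - (a₁ * x + b₁ * h)) + b * (v - (a₂ * x + b₂ * h))
        ≡ (a * u + b * v) - ((a * a₁ + b * a₂) * x + (a * b₁ + b * b₂) * h)
    regroup = solve-∀

  InSpan-sum : ∀ {m′} (c : Fin m′ → ℤ) (v : Fin m′ → Vec' m) → (∀ j → InSpan M X H (v j)) →
               InSpan M X H (λ i → sumFin (λ j → c j * v j i))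
  InSpan-sum {zero}   c v v∈ = InSpan-Im InIm-zero
  InSpan-sum {suc m′} c v v∈ =
    InSpan-resp (λ i → cong (_+_ (c fzero * v fzero i)) (ℤₚ.*-identityˡ _))
      (InSpan-lin (v∈ fzero) (InSpan-sum (c ∘ fsuc) (v ∘ fsuc) (v∈ ∘ fsuc)) (c fzero) (+ 1))

  InSpan-all : (∀ j → InSpan M X H (δ j)) → ∀ t → InSpan M X H t
  InSpan-all δ∈ t = InSpan-resp (λ i → sym (δ-expand t i)) (InSpan-sum t δ δ∈)

  InSpan-X : InSpan M X H X
  InSpan-X = + 1 , + 0 , InIm-resp (λ i → 0≡x-x (X i) (H i)) InIm-zero
    where
    0≡x-x : ∀ x h → + 0 ≡ x - (+ 1 * x + + 0 * h)
    0≡x-x = solve-∀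

  InSpan-H : InSpan M X H H
  InSpan-H = + 0 , + 1 , InIm-resp (λ i → 0≡h-h (X i) (H i)) InIm-zero
    where
    0≡h-h : ∀ x h → + 0 ≡ h - (+ 0 * x + + 1 * h)
    0≡h-h = solve-∀

module Cyclicity {m} {M : Mat m} (M-sym : IsSymmetric M) where

  open Image M

  kernel⊥image : ∀ {R x : Vec' m} → (∀ i → (M · R) i ≡ + 0) → InIm M x → dot R x ≡ + 0
  kernel⊥image {R} {x} MR≡0 (z , x≡Mz) = begin
    dot R x              ≡⟨ sumFin-cong (λ i → cong (R i *_) (x≡Mz i)) ⟩
    dot R (M · z)        ≡⟨ ·-selfAdjoint M-sym R z ⟩
    dot (M · R) z        ≡⟨ sumFin-cong (λ i → trans (cong (_* z i) (MR≡0 i)) (ℤₚ.*-zeroˡ (z i))) ⟩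
    sumFin {m} (λ _ → + 0) ≡⟨ sumFin-zero {m} ⟩
    + 0                  ∎

  kernel⊥torsion : ∀ {R t : Vec' m} → (∀ i → (M · R) i ≡ + 0) → IsTorsion M t → dot R t ≡ + 0
  kernel⊥torsion {R} {t} MR≡0 (suc n , _ , nt∈Im) =
    ℤₚ.*-cancelˡ-≡ (+ suc n) (dot R t) (+ 0)
      (trans (sym (dot-scaleʳ R t (+ suc n)))
             (trans (kernel⊥image MR≡0 nt∈Im) (sym (ℤₚ.*-zeroʳ (+ suc n)))))

  divides-pairing : ∀ {c g : Vec' m} {N j : ℤ} → (∀ i → (M · c) i ≡ N * g i) →
                    InIm M (scale j g) → N ∣ j * dot c g
  divides-pairing {c} {g} {N} {j} Mc≡Ng (z , jg≡Mz) = divides (dot g z) (begin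
    j * dot c g                      ≡⟨ dot-scaleʳ c g j ⟨
    dot c (scale j g)                ≡⟨ sumFin-cong (λ i → cong (c i *_) (jg≡Mz i)) ⟩
    dot c (M · z)                    ≡⟨ ·-selfAdjoint M-sym c z ⟩
    dot (M · c) z                    ≡⟨ sumFin-cong (λ i → trans (cong (_* z i) (Mc≡Ng i))
                                                                 (ℤₚ.*-assoc N (g i) (z i))) ⟩
    sumFin (λ i → N * (g i * z i))   ≡⟨ sumFin-*ˡ {m} N _ ⟩
    N * dot g z                      ≡⟨ ℤₚ.*-comm N _ ⟩
    dot g z * N                      ∎)

  order-divides : ∀ {c g : Vec' m} {N j u v : ℤ} → (∀ i → (M · c) i ≡ N * g i) →
                  u * dot c g + v * N ≡ + 1 → InIm M (scale j g) → N ∣ j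
  order-divides {c} {g} {N} {j} {u} {v} Mc≡Ng bézout jg∈Im =
    subst (N ∣_) j-expansion
      (∣m∣n⇒∣m+n (∣n⇒∣m*n u (divides-pairing {c} {g} {N} {j} Mc≡Ng jg∈Im))
                 (∣n⇒∣m*n (j * v) ∣-refl))
    where
    regroup : ∀ u j d v N → u * (j * d) + j * v * N ≡ j * (u * d + v * N)
    regroup = solve-∀
    j-expansion : u * (j * dot c g) + j * v * N ≡ j
    j-expansion = trans (regroup u j (dot c g) v N) (trans (cong (j *_) bézout) (ℤₚ.*-identityʳ j))

  torsion-multiple : ∀ {R X H g t : Vec' m} {s : ℤ} →
    (∀ i → (M · R) i ≡ + 0) → dot R X ≡ s → dot R H ≡ + 1 → (∀ i → g i ≡ X i - s * H i) →
    InSpan M X H t → IsTorsion M t → Σ ℤ λ a → t ≈[ M ] scale a g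
  torsion-multiple {R} {X} {H} {g} {t} {s} MR≡0 RX≡s RH≡1 g≡X-sH (a , b , rest∈Im) t-tor =
    a , InIm-resp rest≡t-ag rest∈Im
    where
    pairing-vanishes : + 0 ≡ + 0 - (a * s + b * + 1)
    pairing-vanishes = begin
      + 0
        ≡⟨ kernel⊥image MR≡0 rest∈Im ⟨
      dot R (λ i → t i - (a * X i + b * H i))
        ≡⟨ dot-affine R t X H a b ⟩
      dot R t - (a * dot R X + b * dot R H)
        ≡⟨ cong₂ (λ r q → r - (a * q + b * dot R H)) (kernel⊥torsion MR≡0 t-tor) RX≡s ⟩
      + 0 - (a * s + b * dot R H)
        ≡⟨ cong (λ h → + 0 - (a * s + b * h)) RH≡1 ⟩
      + 0 - (a * s + b * + 1) ∎
    b≡-as : b ≡ - (a * s)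
    b≡-as = begin
      b                                      ≡⟨ solve-b a s b ⟩
      - (a * s) - (+ 0 - (a * s + b * + 1)) ≡⟨ cong (_-_ (- (a * s))) pairing-vanishes ⟨
      - (a * s) - + 0                        ≡⟨ ℤₚ.+-identityʳ (- (a * s)) ⟩
      - (a * s)                              ∎
      where
      solve-b : ∀ a s b → b ≡ - (a * s) - (+ 0 - (a * s + b * + 1))
      solve-b = solve-∀
    rest≡t-ag : ∀ i → t i - (a * X i + b * H i) ≡ t i - scale a g i
    rest≡t-ag i = begin
      t i - (a * X i + b * H i)         ≡⟨ cong (λ b′ → t i - (a * X i + b′ * H i)) b≡-as ⟩
      t i - (a * X i + - (a * s) * H i) ≡⟨ factor (t i) a (X i) s (H i) ⟩
      t i - a * (X i - s * H i)         ≡⟨ cong (λ y → t i - a * y) (g≡X-sH i) ⟨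
      t i - scale a g i                 ∎
      where
      factor : ∀ t a x s h → t - (a * x + - (a * s) * h) ≡ t - a * (x - s * h)
      factor = solve-∀

  cyclic-criterion : ∀ {R X H g c : Vec' m} {s u v : ℤ} {N : ℕ} →
    (∀ i → (M · R) i ≡ + 0) → dot R X ≡ s → dot R H ≡ + 1 → (∀ i → g i ≡ X i - s * H i) →
    (∀ t → InSpan M X H t) →
    (∀ i → (M · c) i ≡ + N * g i) → u * dot c g + v * + N ≡ + 1 → 1 ≤ N →
    PhiCyclicOfOrder M N
  cyclic-criterion {R} {X} {H} {g} {c} {s} {u} {v} {N} MR≡0 RX≡s RH≡1 g≡X-sH spanned Mc≡Ng bézout 1≤N =
    g , (N , 1≤N , Ng∈Im) , Ng∈Im , no-smaller-multiple ,
    λ t t-tor → torsion-multiple MR≡0 RX≡s RH≡1 g≡X-sH (spanned t) t-tor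
    where
    Ng∈Im : InIm M (scale (+ N) g)
    Ng∈Im = c , λ i → sym (Mc≡Ng i)
    no-smaller-multiple : ∀ j → 1 ≤ j → j < N → ¬ InIm M (scale (+ j) g)
    no-smaller-multiple j 1≤j j<N jg∈Im =
      >⇒∤ {{ℕ.>-nonZero 1≤j}} j<N
        (∣⇒∣ᵤ (order-divides {c} {g} {+ N} {+ j} {u} {v} Mc≡Ng bézout jg∈Im))

-- Boolean tests and sums over initial segments of ℕ

≡ᵇ-refl : ∀ a → (a ≡ᵇ a) ≡ true
≡ᵇ-refl zero    = refl
≡ᵇ-refl (suc a) = ≡ᵇ-refl a

≡⇒≡ᵇ-true : ∀ {a b} → a ≡ b → (a ≡ᵇ b) ≡ true
≡⇒≡ᵇ-true {a} refl = ≡ᵇ-refl a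

≡ᵇ-true⇒≡ : ∀ a b → (a ≡ᵇ b) ≡ true → a ≡ b
≡ᵇ-true⇒≡ a b e = ℕₚ.≡ᵇ⇒≡ a b (subst T (sym e) _)

≢⇒≡ᵇ-false : ∀ a b → a ≢ b → (a ≡ᵇ b) ≡ false
≢⇒≡ᵇ-false zero    zero    a≢b = ⊥-elim (a≢b refl)
≢⇒≡ᵇ-false zero    (suc b) a≢b = refl
≢⇒≡ᵇ-false (suc a) zero    a≢b = refl
≢⇒≡ᵇ-false (suc a) (suc b) a≢b = ≢⇒≡ᵇ-false a b (a≢b ∘ cong suc)

≡ᵇ-sym : ∀ a b → (a ≡ᵇ b) ≡ (b ≡ᵇ a)
≡ᵇ-sym zero    zero    = refl
≡ᵇ-sym zero    (suc b) = refl
≡ᵇ-sym (suc a) zero    = refl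
≡ᵇ-sym (suc a) (suc b) = ≡ᵇ-sym a b

<⇒<ᵇ-true : ∀ {a b} → a < b → (a <ᵇ b) ≡ true
<⇒<ᵇ-true {a} {b} a<b with a <ᵇ b | ℕₚ.<⇒<ᵇ a<b
... | true | _ = refl

≥⇒<ᵇ-false : ∀ {a b} → b ≤ a → (a <ᵇ b) ≡ false
≥⇒<ᵇ-false {a} {b} b≤a with a <ᵇ b in eq
... | false = refl
... | true  = ⊥-elim (ℕₚ.<⇒≱ (ℕₚ.<ᵇ⇒< a b (subst T (sym eq) _)) b≤a)

𝟙 : Bool → ℤ
𝟙 b = if b then + 1 else + 0

δ-toℕ : ∀ {m} (i j : Fin m) → δ i j ≡ 𝟙 (toℕ i ≡ᵇ toℕ j)
δ-toℕ fzero    fzero    = refl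
δ-toℕ fzero    (fsuc j) = refl
δ-toℕ (fsuc i) fzero    = refl
δ-toℕ (fsuc i) (fsuc j) = δ-toℕ i j

sumTo : (ℕ → ℤ) → ℕ → ℤ
sumTo f zero    = + 0
sumTo f (suc n) = f 0 + sumTo (f ∘ suc) n

sumFin-toℕ : ∀ n (f : ℕ → ℤ) → sumFin {n} (f ∘ toℕ) ≡ sumTo f n
sumFin-toℕ zero    f = refl
sumFin-toℕ (suc n) f = cong (_+_ (f 0)) (sumFin-toℕ n (f ∘ suc))

sumTo-cong : ∀ n {f g : ℕ → ℤ} → (∀ q → q < n → f q ≡ g q) → sumTo f n ≡ sumTo g n
sumTo-cong zero    f≡g = refl
sumTo-cong (suc n) f≡g = cong₂ _+_ (f≡g 0 z<s) (sumTo-cong n (λ q q<n → f≡g (suc q) (s<s q<n)))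

sumTo-*ˡ : ∀ n c (f : ℕ → ℤ) → sumTo (λ q → c * f q) n ≡ c * sumTo f n
sumTo-*ˡ zero    c f = sym (ℤₚ.*-zeroʳ c)
sumTo-*ˡ (suc n) c f =
  trans (cong (_+_ (c * f 0)) (sumTo-*ˡ n c (f ∘ suc))) (sym (ℤₚ.*-distribˡ-+ c _ _))

sumTo-linear : ∀ n c (f g h : ℕ → ℤ) →
               sumTo (λ q → c * f q - (g q + h q)) n ≡ c * sumTo f n - (sumTo g n + sumTo h n)
sumTo-linear zero    c f g h = 0≡ c
  where
  0≡ : ∀ c → + 0 ≡ c * + 0 - (+ 0 + + 0)
  0≡ = solve-∀
sumTo-linear (suc n) c f g h =
  trans (cong (_+_ (c * f 0 - (g 0 + h 0))) (sumTo-linear n c (f ∘ suc) (g ∘ suc) (h ∘ suc)))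
        (regroup c (f 0) (g 0) (h 0) _ _ _)
  where
  regroup : ∀ c f₀ g₀ h₀ F G H →
            (c * f₀ - (g₀ + h₀)) + (c * F - (G + H)) ≡ c * (f₀ + F) - ((g₀ + G) + (h₀ + H))
  regroup = solve-∀

sumTo-zero : ∀ n (f : ℕ → ℤ) → (∀ q → q < n → f q ≡ + 0) → sumTo f n ≡ + 0
sumTo-zero zero    f f≡0 = refl
sumTo-zero (suc n) f f≡0 = cong₂ _+_ (f≡0 0 z<s) (sumTo-zero n (f ∘ suc) (λ q q<n → f≡0 (suc q) (s<s q<n)))

sumTo-indicator : ∀ n t (w : ℕ → ℤ) → t < n → sumTo (λ q → 𝟙 (q ≡ᵇ t) * w q) n ≡ w t
sumTo-indicator (suc n) zero w _ = begin
  + 1 * w 0 + sumTo (λ q → + 0 * w (suc q)) n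
    ≡⟨ cong₂ _+_ (ℤₚ.*-identityˡ (w 0)) (sumTo-zero n _ (λ q _ → ℤₚ.*-zeroˡ (w (suc q)))) ⟩
  w 0 + + 0
    ≡⟨ ℤₚ.+-identityʳ (w 0) ⟩
  w 0 ∎
sumTo-indicator (suc n) (suc t) w (s<s t<n) =
  trans (cong₂ _+_ (ℤₚ.*-zeroˡ (w 0)) (sumTo-indicator n t (w ∘ suc) t<n)) (ℤₚ.+-identityˡ _)

sumTo-indicatorʳ : ∀ n t (w : ℕ → ℤ) → t < n → sumTo (λ q → w q * 𝟙 (q ≡ᵇ t)) n ≡ w t
sumTo-indicatorʳ n t w t<n =
  trans (sumTo-cong n (λ q _ → ℤₚ.*-comm (w q) (𝟙 (q ≡ᵇ t)))) (sumTo-indicator n t w t<n)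

sumTo-snoc : ∀ n (f : ℕ → ℤ) → sumTo f (suc n) ≡ sumTo f n + f n
sumTo-snoc zero    f = ℤₚ.+-comm (f 0) (+ 0)
sumTo-snoc (suc n) f =
  trans (cong (_+_ (f 0)) (sumTo-snoc n (f ∘ suc))) (sym (ℤₚ.+-assoc (f 0) _ _))

sumTo-+-range : ∀ a b (f : ℕ → ℤ) → sumTo f (a ℕ.+ b) ≡ sumTo f a + sumTo (λ q → f (a ℕ.+ q)) b
sumTo-+-range zero    b f = sym (ℤₚ.+-identityˡ _)
sumTo-+-range (suc a) b f =
  trans (cong (_+_ (f 0)) (sumTo-+-range a b (f ∘ suc))) (sym (ℤₚ.+-assoc (f 0) _ _))

sumTo-reverse : ∀ n (f : ℕ → ℤ) → sumTo (λ q → f (n ∸ q)) n ≡ sumTo (f ∘ suc) n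
sumTo-reverse zero    f = refl
sumTo-reverse (suc n) f = begin
  f (suc n) + sumTo (λ q → f (n ∸ q)) n  ≡⟨ cong (_+_ (f (suc n))) (sumTo-reverse n f) ⟩
  f (suc n) + sumTo (f ∘ suc) n          ≡⟨ ℤₚ.+-comm (f (suc n)) _ ⟩
  sumTo (f ∘ suc) n + f (suc n)          ≡⟨ sumTo-snoc n (f ∘ suc) ⟨
  sumTo (f ∘ suc) (suc n)                ∎

sumTo-id : ∀ n → + 2 * sumTo (λ q → + q) n ≡ + n * (+ n - + 1)
sumTo-id zero    = refl
sumTo-id (suc n) = begin
  + 2 * sumTo (λ q → + q) (suc n)        ≡⟨ cong (+ 2 *_) (sumTo-snoc n (λ q → + q)) ⟩
  + 2 * (sumTo (λ q → + q) n + + n)      ≡⟨ ℤₚ.*-distribˡ-+ (+ 2) (sumTo (λ q → + q) n) (+ n) ⟩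
  + 2 * sumTo (λ q → + q) n + + 2 * + n  ≡⟨ cong (_+ + 2 * + n) (sumTo-id n) ⟩
  + n * (+ n - + 1) + + 2 * + n          ≡⟨ step (+ n) ⟩
  + suc n * (+ suc n - + 1)              ∎
  where
  step : ∀ x → x * (x - + 1) + + 2 * x ≡ (+ 1 + x) * ((+ 1 + x) - + 1)
  step = solve-∀

sumTo-affine : ∀ n a b → sumTo (λ q → a + + q * b) n ≡ + n * a + sumTo (λ q → + q) n * b
sumTo-affine zero    a b = 0≡ a b
  where
  0≡ : ∀ a b → + 0 ≡ + 0 * a + + 0 * b
  0≡ = solve-∀
sumTo-affine (suc n) a b = begin
  sumTo (λ q → a + + q * b) (suc n)
    ≡⟨ sumTo-snoc n _ ⟩
  sumTo (λ q → a + + q * b) n + (a + + n * b)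
    ≡⟨ cong (_+ (a + + n * b)) (sumTo-affine n a b) ⟩
  + n * a + sumTo (λ q → + q) n * b + (a + + n * b)
    ≡⟨ regroup a b (sumTo (λ q → + q) n) (+ n) ⟩
  + suc n * a + (sumTo (λ q → + q) n + + n) * b
    ≡⟨ cong (λ s → + suc n * a + s * b) (sumTo-snoc n (λ q → + q)) ⟨
  + suc n * a + sumTo (λ q → + q) (suc n) * b ∎
  where
  regroup : ∀ a b T x → x * a + T * b + (a + x * b) ≡ (+ 1 + x) * a + (T + x) * b
  regroup = solve-∀

-- Wheel matrices

𝟙-∨ : ∀ x y → (x ≡ true → y ≡ true → ⊥) → 𝟙 (x ∨ y) ≡ 𝟙 x + 𝟙 y
𝟙-∨ true  true  disjoint = ⊥-elim (disjoint refl refl)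
𝟙-∨ true  false _        = refl
𝟙-∨ false true  _        = refl
𝟙-∨ false false _        = refl

cycSucc : ℕ → ℕ → ℕ
cycSucc n r = if suc r ≡ᵇ n then 0 else suc r

cycPred : ℕ → ℕ → ℕ
cycPred n zero    = n ∸ 1
cycPred n (suc r) = r

cycSucc-inner : ∀ {n r} → suc r < n → cycSucc n r ≡ suc r
cycSucc-inner {n} {r} r+1<n =
  cong (if_then 0 else suc r) (≢⇒≡ᵇ-false (suc r) n (ℕₚ.<⇒≢ r+1<n))

cycSucc-< : ∀ {n r} → r < n → cycSucc n r < n
cycSucc-< {n} {r} r<n with suc r ≡ᵇ n in eq
... | true  = ℕₚ.≤-trans (s≤s z≤n) r<n
... | false = ℕₚ.≤∧≢⇒< r<n (λ r+1≡n → true≢false (trans (sym (≡⇒≡ᵇ-true r+1≡n)) eq))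
  where
  true≢false : true ≢ false
  true≢false ()

cycPred-< : ∀ {n r} → r < n → cycPred n r < n
cycPred-< {suc n} {zero}  _   = ℕₚ.n<1+n n
cycPred-< {n}     {suc r} r<n = ℕₚ.<-trans (ℕₚ.n<1+n r) r<n

≡ᵇ-exclusive : ∀ {a b} q → a ≢ b → (q ≡ᵇ a) ≡ true → (q ≡ᵇ b) ≡ true → ⊥
≡ᵇ-exclusive q a≢b q≡a q≡b = a≢b (trans (sym (≡ᵇ-true⇒≡ q _ q≡a)) (≡ᵇ-true⇒≡ q _ q≡b))

cycAdj-first : ∀ n q → 𝟙 (cycAdjᵇ (3 ℕ.+ n) 0 q) ≡ 𝟙 (q ≡ᵇ 1) + 𝟙 (q ≡ᵇ 2 ℕ.+ n)
cycAdj-first n q = begin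
  𝟙 ((q ≡ᵇ 1) ∨ ((q ≡ᵇ 2 ℕ.+ n) ∨ ((q ≡ᵇ 0) ∧ false)))
    ≡⟨ cong (λ b → 𝟙 ((q ≡ᵇ 1) ∨ ((q ≡ᵇ 2 ℕ.+ n) ∨ b))) (∧-zeroʳ (q ≡ᵇ 0)) ⟩
  𝟙 ((q ≡ᵇ 1) ∨ ((q ≡ᵇ 2 ℕ.+ n) ∨ false))
    ≡⟨ cong (λ b → 𝟙 ((q ≡ᵇ 1) ∨ b)) (∨-identityʳ (q ≡ᵇ 2 ℕ.+ n)) ⟩
  𝟙 ((q ≡ᵇ 1) ∨ (q ≡ᵇ 2 ℕ.+ n))
    ≡⟨ 𝟙-∨ _ _ (≡ᵇ-exclusive q (λ ())) ⟩
  𝟙 (q ≡ᵇ 1) + 𝟙 (q ≡ᵇ 2 ℕ.+ n) ∎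

cycAdj-last : ∀ n q → q < 3 ℕ.+ n →
              𝟙 (cycAdjᵇ (3 ℕ.+ n) (2 ℕ.+ n) q) ≡ 𝟙 (q ≡ᵇ 0) + 𝟙 (q ≡ᵇ 1 ℕ.+ n)
cycAdj-last n q q<n+3 = begin
  𝟙 ((q ≡ᵇ 3 ℕ.+ n) ∨ ((1 ℕ.+ n ≡ᵇ q) ∨ ((q ≡ᵇ 0) ∧ (n ≡ᵇ n))))
    ≡⟨ cong₂ (λ x y → 𝟙 (x ∨ ((1 ℕ.+ n ≡ᵇ q) ∨ ((q ≡ᵇ 0) ∧ y))))
             (≢⇒≡ᵇ-false q _ (ℕₚ.<⇒≢ q<n+3)) (≡ᵇ-refl n) ⟩
  𝟙 ((1 ℕ.+ n ≡ᵇ q) ∨ ((q ≡ᵇ 0) ∧ true))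
    ≡⟨ cong₂ (λ x y → 𝟙 (x ∨ y)) (≡ᵇ-sym (1 ℕ.+ n) q) (∧-identityʳ (q ≡ᵇ 0)) ⟩
  𝟙 ((q ≡ᵇ 1 ℕ.+ n) ∨ (q ≡ᵇ 0))
    ≡⟨ 𝟙-∨ _ _ (≡ᵇ-exclusive q (λ ())) ⟩
  𝟙 (q ≡ᵇ 1 ℕ.+ n) + 𝟙 (q ≡ᵇ 0)
    ≡⟨ ℤₚ.+-comm (𝟙 (q ≡ᵇ 1 ℕ.+ n)) _ ⟩
  𝟙 (q ≡ᵇ 0) + 𝟙 (q ≡ᵇ 1 ℕ.+ n) ∎

cycAdj-inner : ∀ n r q → r ≢ 1 ℕ.+ n →
               𝟙 (cycAdjᵇ (3 ℕ.+ n) (suc r) q) ≡ 𝟙 (q ≡ᵇ 2 ℕ.+ r) + 𝟙 (q ≡ᵇ r)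
cycAdj-inner n r q r≢n+1 = begin
  𝟙 ((q ≡ᵇ 2 ℕ.+ r) ∨ ((r ≡ᵇ q) ∨ ((q ≡ᵇ 0) ∧ (r ≡ᵇ 1 ℕ.+ n))))
    ≡⟨ cong (λ b → 𝟙 ((q ≡ᵇ 2 ℕ.+ r) ∨ ((r ≡ᵇ q) ∨ ((q ≡ᵇ 0) ∧ b)))) (≢⇒≡ᵇ-false r _ r≢n+1) ⟩
  𝟙 ((q ≡ᵇ 2 ℕ.+ r) ∨ ((r ≡ᵇ q) ∨ ((q ≡ᵇ 0) ∧ false)))
    ≡⟨ cong (λ b → 𝟙 ((q ≡ᵇ 2 ℕ.+ r) ∨ ((r ≡ᵇ q) ∨ b))) (∧-zeroʳ (q ≡ᵇ 0)) ⟩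
  𝟙 ((q ≡ᵇ 2 ℕ.+ r) ∨ ((r ≡ᵇ q) ∨ false))
    ≡⟨ cong (λ b → 𝟙 ((q ≡ᵇ 2 ℕ.+ r) ∨ b)) (trans (∨-identityʳ (r ≡ᵇ q)) (≡ᵇ-sym r q)) ⟩
  𝟙 ((q ≡ᵇ 2 ℕ.+ r) ∨ (q ≡ᵇ r))
    ≡⟨ 𝟙-∨ _ _ (≡ᵇ-exclusive q (ℕₚ.>⇒≢ (ℕₚ.m<n+m r z<s))) ⟩
  𝟙 (q ≡ᵇ 2 ℕ.+ r) + 𝟙 (q ≡ᵇ r) ∎

cycAdj-split : ∀ n r q → 3 ≤ n → q < n →
               𝟙 (cycAdjᵇ n r q) ≡ 𝟙 (q ≡ᵇ cycSucc n r) + 𝟙 (q ≡ᵇ cycPred n r)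
cycAdj-split (suc zero)          _       _ (s≤s ())       _
cycAdj-split (suc (suc zero))    _       _ (s≤s (s≤s ())) _
cycAdj-split (suc (suc (suc n))) zero    q _ _ = cycAdj-first n q
cycAdj-split (suc (suc (suc n))) (suc r) q _ q<n with r ℕₚ.≟ suc n
... | yes refl =
  trans (cycAdj-last n q q<n)
        (cong (λ b → 𝟙 (q ≡ᵇ (if b then 0 else 3 ℕ.+ n)) + 𝟙 (q ≡ᵇ 1 ℕ.+ n)) (sym (≡ᵇ-refl n)))
... | no r≢n+1 =
  trans (cycAdj-inner n r q r≢n+1)
        (cong (λ b → 𝟙 (q ≡ᵇ (if b then 0 else 2 ℕ.+ r)) + 𝟙 (q ≡ᵇ r)) (sym (≢⇒≡ᵇ-false r _ r≢n+1)))

wheelAdj-sym : ∀ n → IsSymmetric (wheelAdj n)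
wheelAdj-sym n fzero    fzero    = refl
wheelAdj-sym n fzero    (fsuc j) = refl
wheelAdj-sym n (fsuc i) fzero    = refl
wheelAdj-sym n (fsuc i) (fsuc j) = cong (if_then + 1 else + 0) (swap-ends
  (toℕ j ≡ᵇ suc (toℕ i)) (toℕ i ≡ᵇ suc (toℕ j))
  ((toℕ i ≡ᵇ 0) ∧ (toℕ j ≡ᵇ (n ∸ 1))) ((toℕ j ≡ᵇ 0) ∧ (toℕ i ≡ᵇ (n ∸ 1))))
  where
  swap-ends : ∀ a b x y → a ∨ (b ∨ (x ∨ y)) ≡ b ∨ (a ∨ (y ∨ x))
  swap-ends true  true  x     y     = refl
  swap-ends true  false x     y     = refl
  swap-ends false true  x     y     = refl
  swap-ends false false true  true  = refl
  swap-ends false false true  false = refl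
  swap-ends false false false true  = refl
  swap-ends false false false false = refl

wheelVec : ∀ {n} → ℤ → (ℕ → ℤ) → Vec' (suc n)
wheelVec h w fzero    = h
wheelVec h w (fsuc p) = w (toℕ p)

dot-wheelVec : ∀ {n} a b (u v : ℕ → ℤ) →
               dot {suc n} (wheelVec a u) (wheelVec b v) ≡ a * b + sumTo (λ r → u r * v r) n
dot-wheelVec {n} a b u v = cong (_+_ (a * b)) (sumFin-toℕ n (λ r → u r * v r))

module WheelMatrix (n : ℕ) (3≤n : 3 ≤ n) (a : Fin (suc n) → ℕ) where

  M : Mat (suc n)
  M i j = Diag a i j - wheelAdj n i j

  open Image M

  M-sym : IsSymmetric M
  M-sym i j = cong₂ _-_ (Diag-sym a i j) (wheelAdj-sym n i j)

  cycle-entry : ∀ (i j : Fin n) →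
    M (fsuc i) (fsuc j) ≡ + a (fsuc i) * 𝟙 (toℕ j ≡ᵇ toℕ i)
                          - (𝟙 (toℕ j ≡ᵇ cycSucc n (toℕ i)) + 𝟙 (toℕ j ≡ᵇ cycPred n (toℕ i)))
  cycle-entry i j =
    cong₂ _-_ (trans (Diag-δ (a ∘ fsuc) i j)
                     (cong (+ a (fsuc i) *_) (trans (δ-toℕ i j) (cong 𝟙 (≡ᵇ-sym (toℕ i) (toℕ j))))))
              (cycAdj-split n (toℕ i) (toℕ j) 3≤n (Finₚ.toℕ<n j))

  hub-row : ∀ h w → (M · wheelVec h w) fzero ≡ + a fzero * h - sumTo w n
  hub-row h w = begin
    (+ a fzero - + 0) * h + sumFin {n} (λ j → (+ 0 - + 1) * w (toℕ j))
      ≡⟨ cong (_+_ ((+ a fzero - + 0) * h)) (trans (sumFin-toℕ n _) (sumTo-*ˡ n (+ 0 - + 1) w)) ⟩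
    (+ a fzero - + 0) * h + (+ 0 - + 1) * sumTo w n
      ≡⟨ simplify (+ a fzero) h (sumTo w n) ⟩
    + a fzero * h - sumTo w n ∎
    where
    simplify : ∀ a h S → (a - + 0) * h + (+ 0 - + 1) * S ≡ a * h - S
    simplify = solve-∀

  cycle-row : ∀ h w (i : Fin n) →
    (M · wheelVec h w) (fsuc i)
      ≡ + a (fsuc i) * w (toℕ i) - (w (cycSucc n (toℕ i)) + w (cycPred n (toℕ i))) - h
  cycle-row h w i = begin
    (+ 0 - + 1) * h + sumFin {n} (λ j → M (fsuc i) (fsuc j) * w (toℕ j))
      ≡⟨ cong (_+_ ((+ 0 - + 1) * h)) row-sum ⟩
    (+ 0 - + 1) * h + (d * w r - (w s + w p))
      ≡⟨ simplify h (d * w r - (w s + w p)) ⟩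
    d * w r - (w s + w p) - h ∎
    where
    r = toℕ i
    s = cycSucc n r
    p = cycPred n r
    d = + a (fsuc i)
    r<n : r < n
    r<n = Finₚ.toℕ<n i
    simplify : ∀ h X → (+ 0 - + 1) * h + X ≡ X - h
    simplify = solve-∀
    distribute : ∀ d e e′ e″ x → (d * e - (e′ + e″)) * x ≡ d * (e * x) - (e′ * x + e″ * x)
    distribute = solve-∀
    row-sum : sumFin {n} (λ j → M (fsuc i) (fsuc j) * w (toℕ j)) ≡ d * w r - (w s + w p)
    row-sum = begin
      sumFin {n} (λ j → M (fsuc i) (fsuc j) * w (toℕ j))
        ≡⟨ sumFin-cong {n} (λ j → trans (cong (_* w (toℕ j)) (cycle-entry i j))
                                        (distribute d (𝟙 (toℕ j ≡ᵇ r)) (𝟙 (toℕ j ≡ᵇ s))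
                                                      (𝟙 (toℕ j ≡ᵇ p)) (w (toℕ j)))) ⟩
      sumFin {n} (λ j → d * (𝟙 (toℕ j ≡ᵇ r) * w (toℕ j))
                    - (𝟙 (toℕ j ≡ᵇ s) * w (toℕ j) + 𝟙 (toℕ j ≡ᵇ p) * w (toℕ j)))
        ≡⟨ sumFin-toℕ n (λ q → d * (𝟙 (q ≡ᵇ r) * w q) - (𝟙 (q ≡ᵇ s) * w q + 𝟙 (q ≡ᵇ p) * w q)) ⟩
      sumTo (λ q → d * (𝟙 (q ≡ᵇ r) * w q) - (𝟙 (q ≡ᵇ s) * w q + 𝟙 (q ≡ᵇ p) * w q)) n
        ≡⟨ sumTo-linear n d _ _ _ ⟩
      d * sumTo (λ q → 𝟙 (q ≡ᵇ r) * w q) n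
        - (sumTo (λ q → 𝟙 (q ≡ᵇ s) * w q) n + sumTo (λ q → 𝟙 (q ≡ᵇ p) * w q) n)
        ≡⟨ cong₂ (λ x y → d * x - y) (sumTo-indicator n r w r<n)
                 (cong₂ _+_ (sumTo-indicator n s w (cycSucc-< r<n))
                            (sumTo-indicator n p w (cycPred-< r<n))) ⟩
      d * w r - (w s + w p) ∎

  hubVec : Vec' (suc n)
  hubVec = wheelVec (+ 1) (λ _ → + 0)

  cycleVec : ℕ → Vec' (suc n)
  cycleVec p = wheelVec (+ 0) (λ q → 𝟙 (q ≡ᵇ p))

  open Span M (cycleVec 0) hubVec

  Spanned : Vec' (suc n) → Set
  Spanned = InSpan M (cycleVec 0) hubVec

  column : Fin n → Vec' (suc n)
  column i = wheelVec (+ 0 - + 1) (λ q → + a (fsuc i) * 𝟙 (q ≡ᵇ toℕ i)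
                                         - (𝟙 (q ≡ᵇ cycSucc n (toℕ i)) + 𝟙 (q ≡ᵇ cycPred n (toℕ i))))

  column∈Im : ∀ i → InIm M (column i)
  column∈Im i = InIm-resp entry (InIm-column (fsuc i))
    where
    entry : ∀ j → M j (fsuc i) ≡ column i j
    entry fzero    = refl
    entry (fsuc j) = trans (M-sym (fsuc j) (fsuc i)) (cycle-entry i j)

  -- Column v_r of M is d e_{v_r} - e_{v_{r+1}} - e_{v_{r-1}} - e_u, so modulo Im M
  -- e_{v_{r+1}} ≡ d e_{v_r} - e_{v_{r-1}} - e_u.
  rotate : ∀ (i : Fin n) → Spanned (cycleVec (toℕ i)) → Spanned (cycleVec (cycPred n (toℕ i))) →
           Spanned (cycleVec (cycSucc n (toℕ i)))
  rotate i Eᵣ Eᵣ₋₁ =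
    InSpan-resp entry
      (InSpan-lin {dEᵣ-Eᵣ₋₁-col} {hubVec}
        (InSpan-lin {dEᵣ-Eᵣ₋₁} {column i}
          (InSpan-lin {cycleVec r} {cycleVec (cycPred n r)} Eᵣ Eᵣ₋₁ d (- + 1))
          (InSpan-Im (column∈Im i)) (+ 1) (- + 1))
        InSpan-H (+ 1) (- + 1))
    where
    r = toℕ i
    d = + a (fsuc i)
    dEᵣ-Eᵣ₋₁ : Vec' (suc n)
    dEᵣ-Eᵣ₋₁ j = d * cycleVec r j + - + 1 * cycleVec (cycPred n r) j
    dEᵣ-Eᵣ₋₁-col : Vec' (suc n)
    dEᵣ-Eᵣ₋₁-col j = + 1 * dEᵣ-Eᵣ₋₁ j + - + 1 * column i j
    hub : ∀ d → + 1 * (+ 1 * (d * + 0 + - + 1 * + 0) + - + 1 * (+ 0 - + 1)) + - + 1 * + 1 ≡ + 0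
    hub = solve-∀
    cycle : ∀ d e e′ e″ → + 1 * (+ 1 * (d * e + - + 1 * e″) + - + 1 * (d * e - (e′ + e″))) + - + 1 * + 0 ≡ e′
    cycle = solve-∀
    entry : ∀ j → + 1 * dEᵣ-Eᵣ₋₁-col j + - + 1 * hubVec j ≡ cycleVec (cycSucc n r) j
    entry fzero    = hub d
    entry (fsuc j) = cycle d (𝟙 (toℕ j ≡ᵇ r)) (𝟙 (toℕ j ≡ᵇ cycSucc n r)) (𝟙 (toℕ j ≡ᵇ cycPred n r))

  spanned-prefix : Spanned (cycleVec (n ∸ 1)) → ∀ p → p < n →
                   Spanned (cycleVec p) × Spanned (cycleVec (cycPred n p))
  spanned-prefix last∈ zero    _     = InSpan-X , last∈
  spanned-prefix last∈ (suc p) p+1<n = subst (Spanned ∘ cycleVec) (cycSucc-inner p+1<n) Eₚ₊₁ , Eₚ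
    where
    p<n = ℕₚ.<-trans (ℕₚ.n<1+n p) p+1<n
    Eₚ   = proj₁ (spanned-prefix last∈ p p<n)
    Eₚ₋₁ = proj₂ (spanned-prefix last∈ p p<n)
    Eₚ₊₁ : Spanned (cycleVec (cycSucc n p))
    Eₚ₊₁ = subst (λ r → Spanned (cycleVec r) → Spanned (cycleVec (cycPred n r)) →
                        Spanned (cycleVec (cycSucc n r)))
                 (Finₚ.toℕ-fromℕ< p<n) (rotate (fromℕ< p<n)) Eₚ Eₚ₋₁

  spanned : Spanned (cycleVec (n ∸ 1)) → ∀ t → Spanned t
  spanned last∈ = InSpan-all basis
    where
    basis : ∀ j → Spanned (δ j)
    basis fzero    = InSpan-resp hub≡δ InSpan-H
      where
      hub≡δ : ∀ i → hubVec i ≡ δ fzero i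
      hub≡δ fzero    = refl
      hub≡δ (fsuc i) = refl
    basis (fsuc q) = InSpan-resp cycle≡δ (proj₁ (spanned-prefix last∈ (toℕ q) (Finₚ.toℕ<n q)))
      where
      cycle≡δ : ∀ i → cycleVec (toℕ q) i ≡ δ (fsuc q) i
      cycle≡δ fzero    = refl
      cycle≡δ (fsuc i) = sym (trans (δ-toℕ q i) (cong 𝟙 (≡ᵇ-sym (toℕ q) (toℕ i))))

-- The labelling v_i, w_i of the cycle of W_{2k} and the numbers s_i

drop-applyUpTo : ∀ {i n} (f : ℕ → ℕ) → i < n →
                 drop i (applyUpTo f n) ≡ f i ∷ drop (suc i) (applyUpTo f n)
drop-applyUpTo {zero}  {suc n} f _         = refl
drop-applyUpTo {suc i} {suc n} f (s<s i<n) = drop-applyUpTo (f ∘ suc) i<n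

drop-applyUpTo-all : ∀ n (f : ℕ → ℕ) → drop n (applyUpTo f n) ≡ []
drop-applyUpTo-all zero    f = refl
drop-applyUpTo-all (suc n) f = drop-applyUpTo-all n (f ∘ suc)

sum-map-applyUpTo : ∀ n (g f : ℕ → ℕ) → + sum (map g (applyUpTo f n)) ≡ sumTo (λ p → + g (f p)) n
sum-map-applyUpTo zero    g f = refl
sum-map-applyUpTo (suc n) g f =
  trans (ℤₚ.pos-+ (g (f 0)) _) (cong (_+_ (+ g (f 0))) (sum-map-applyUpTo n g (f ∘ suc)))

sIdx-step : ∀ k i → i ≤ k → sIdx k i ≡ i ℕ.+ sIdx k (suc i)
sIdx-step k i i≤k = cong sum (drop-applyUpTo id (s≤s i≤k))

sIdx-beyond : ∀ k → sIdx k (suc k) ≡ 0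
sIdx-beyond k = cong sum (drop-applyUpTo-all (suc k) id)

sIdx-pos : ∀ k i → 1 ≤ i → i ≤ k → 0 < sIdx k i
sIdx-pos k i 1≤i i≤k =
  subst (0 <_) (sym (sIdx-step k i i≤k)) (ℕₚ.<-≤-trans 1≤i (ℕₚ.m≤m+n i (sIdx k (suc i))))

sIdx-first : ∀ k → + 2 * + sIdx k 1 ≡ + k * (+ k + + 1)
sIdx-first k = begin
  + 2 * + sIdx k 1
    ≡⟨ cong (λ l → + 2 * + sum l) (map-id (applyUpTo suc k)) ⟨
  + 2 * + sum (map id (applyUpTo suc k))
    ≡⟨ cong (+ 2 *_) (sum-map-applyUpTo k id suc) ⟩
  + 2 * sumTo (λ q → + 1 + + q) k
    ≡⟨ cong (+ 2 *_) (trans (sumTo-cong k (λ q _ → affine (+ q))) (sumTo-affine k (+ 1) (+ 1))) ⟩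
  + 2 * (+ k * + 1 + sumTo (λ q → + q) k * + 1)
    ≡⟨ expand (+ k) (sumTo (λ q → + q) k) ⟩
  + 2 * + k + + 2 * sumTo (λ q → + q) k
    ≡⟨ cong (_+_ (+ 2 * + k)) (sumTo-id k) ⟩
  + 2 * + k + + k * (+ k - + 1)
    ≡⟨ collect (+ k) ⟩
  + k * (+ k + + 1) ∎
  where
  affine : ∀ q → + 1 + q ≡ + 1 + q * + 1
  affine = solve-∀
  expand : ∀ k T → + 2 * (k * + 1 + T * + 1) ≡ + 2 * k + + 2 * T
  expand = solve-∀
  collect : ∀ k → + 2 * k + k * (k - + 1) ≡ k * (k + + 1)
  collect = solve-∀

aHub-sum : ∀ k → + aHub k ≡ + 2 * sumTo (λ q → + sIdx k (suc q)) k
aHub-sum k = trans (ℤₚ.pos-* 2 (sum (map (sIdx k) (applyUpTo suc k))))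
                   (cong (+ 2 *_) (sum-map-applyUpTo k (sIdx k) suc))

cycIndex-v : ∀ {k r} → r < k → cycIndex k r ≡ suc r
cycIndex-v {k} {r} r<k = cong (if_then suc r else (k ℕ.+ k) ∸ r) (<⇒<ᵇ-true r<k)

cycIndex-w : ∀ k q e {x} → x ≡ k ℕ.+ q → q ℕ.+ suc e ≡ k → cycIndex k x ≡ suc e
cycIndex-w k q e refl q+e+1≡k = begin
  cycIndex k (k ℕ.+ q)
    ≡⟨ cong (if_then suc (k ℕ.+ q) else (k ℕ.+ k) ∸ (k ℕ.+ q)) (≥⇒<ᵇ-false (ℕₚ.m≤m+n k q)) ⟩
  (k ℕ.+ k) ∸ (k ℕ.+ q)   ≡⟨ ℕₚ.[m+n]∸[m+o]≡n∸o k k q ⟩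
  k ∸ q                    ≡⟨ cong (_∸ q) q+e+1≡k ⟨
  (q ℕ.+ suc e) ∸ q        ≡⟨ ℕₚ.m+n∸m≡n q (suc e) ⟩
  suc e                    ∎

m+[1+[n∸1+m]]≡n : ∀ {q k} → q < k → q ℕ.+ suc (k ∸ suc q) ≡ k
m+[1+[n∸1+m]]≡n {q} q<k = trans (ℕₚ.+-suc q _) (ℕₚ.m+[n∸m]≡n q<k)

cycIndex-range : ∀ {k r} → r < k ℕ.+ k → 1 ≤ cycIndex k r × cycIndex k r ≤ k
cycIndex-range {k} {r} r<2k with r ℕ.<? k
... | yes r<k = subst (λ i → 1 ≤ i × i ≤ k) (sym (cycIndex-v r<k)) (s≤s z≤n , r<k)
... | no r≮k  = subst (λ i → 1 ≤ i × i ≤ k) (sym (cycIndex-w k q e (sym k+q≡r) q+e+1≡k))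
                      (s≤s z≤n , subst (suc e ≤_) q+e+1≡k (ℕₚ.m≤n+m (suc e) q))
  where
  q = r ∸ k
  e = k ∸ suc q
  k+q≡r : k ℕ.+ q ≡ r
  k+q≡r = ℕₚ.m+[n∸m]≡n (ℕₚ.≮⇒≥ r≮k)
  q+e+1≡k : q ℕ.+ suc e ≡ k
  q+e+1≡k = m+[1+[n∸1+m]]≡n (ℕₚ.+-cancelˡ-< k q k (subst (_< k ℕ.+ k) (sym k+q≡r) r<2k))

byIndex : ℕ → (ℕ → ℤ) → (ℕ → ℤ) → ℕ → ℤ
byIndex k V W r = if r <ᵇ k then V (cycIndex k r) else W (cycIndex k r)

byIndex-v : ∀ {k r} (V W : ℕ → ℤ) → r < k → byIndex k V W r ≡ V (suc r)
byIndex-v {k} {r} V W r<k =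
  trans (cong (λ b → if b then V (cycIndex k r) else W (cycIndex k r)) (<⇒<ᵇ-true r<k))
        (cong V (cycIndex-v r<k))

byIndex-w : ∀ k q e {x} (V W : ℕ → ℤ) → x ≡ k ℕ.+ q → q ℕ.+ suc e ≡ k → byIndex k V W x ≡ W (suc e)
byIndex-w k q e {x} V W x≡k+q q+e+1≡k =
  trans (cong (λ b → if b then V (cycIndex k x) else W (cycIndex k x))
              (≥⇒<ᵇ-false (subst (k ≤_) (sym x≡k+q) (ℕₚ.m≤m+n k q))))
        (cong W (cycIndex-w k q e x≡k+q q+e+1≡k))

byIndex-same : ∀ k (V : ℕ → ℤ) r → byIndex k V V r ≡ V (cycIndex k r)
byIndex-same k V r with r <ᵇ k
... | true  = refl
... | false = refl

sumTo-byIndex : ∀ k (V W : ℕ → ℤ) →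
                sumTo (byIndex k V W) (k ℕ.+ k) ≡ sumTo (V ∘ suc) k + sumTo (W ∘ suc) k
sumTo-byIndex k V W = begin
  sumTo (byIndex k V W) (k ℕ.+ k)
    ≡⟨ sumTo-+-range k k _ ⟩
  sumTo (byIndex k V W) k + sumTo (λ q → byIndex k V W (k ℕ.+ q)) k
    ≡⟨ cong₂ _+_ (sumTo-cong k (λ r r<k → byIndex-v V W r<k))
                 (sumTo-cong k (λ q q<k → byIndex-w k q (k ∸ suc q) V W refl (m+[1+[n∸1+m]]≡n q<k))) ⟩
  sumTo (V ∘ suc) k + sumTo (λ q → W (suc (k ∸ suc q))) k
    ≡⟨ cong (_+_ (sumTo (V ∘ suc) k))
            (trans (sumTo-cong k (λ q q<k → cong W (sym (ℕₚ.+-∸-assoc 1 q<k)))) (sumTo-reverse k W)) ⟩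
  sumTo (V ∘ suc) k + sumTo (W ∘ suc) k ∎

row-cong : ∀ {d d′ : ℕ} {x x′ y y′ z z′ h : ℤ} → d ≡ d′ → x ≡ x′ → y ≡ y′ → z ≡ z′ →
           + d * x - (y + z) - h ≡ + d′ * x′ - (y′ + z′) - h
row-cong refl refl refl refl = refl

-- The arithmetical structure on W_{2k}, k = m + 2

module Wheel2k (m : ℕ) where

  k : ℕ
  k = suc (suc m)

  n : ℕ
  n = k ℕ.+ k

  K : ℤ
  K = + k

  3≤n : 3 ≤ n
  3≤n = s≤s (s≤s (ℕₚ.≤-trans (s≤s z≤n) (ℕₚ.m≤n+m k m)))

  open WheelMatrix n 3≤n (diagW k)

  last : ℕ
  last = suc (k ℕ.+ m)

  last+1≡n : suc last ≡ n
  last+1≡n = sym (trans (ℕₚ.+-suc k (suc m)) (cong suc (ℕₚ.+-suc k m)))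

  n∸1≡last : n ∸ 1 ≡ last
  n∸1≡last = cong (_∸ 1) (sym last+1≡n)

  <k⇒<n : ∀ {x} → x < k → x < n
  <k⇒<n x<k = ℕₚ.<-≤-trans x<k (ℕₚ.m≤m+n k k)

  +2<n : ∀ {x} → x < k ℕ.+ m → suc (suc x) < n
  +2<n {x} x<k+m = subst (suc (suc x) <_) last+1≡n (s<s (s<s x<k+m))

  -- Cycle positions 0 … n-1 split as v₁ | v₂ … v_{k-1} | v_k | w_k | w_{k-1} … w₂ | w₁.
  by-region : ∀ (P : ℕ → Set) → P 0 → (∀ j → j < m → P (suc j)) → P (suc m) → P k →
              (∀ q e → q ℕ.+ suc e ≡ m → P (suc (k ℕ.+ q))) → P last → ∀ r → r < n → P r
  by-region P v₁ vᵢ vₖ wₖ wᵢ w₁ r r<n with r ℕ.<? k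
  ... | yes r<k = v-side r r<k
    where
    v-side : ∀ r → r < k → P r
    v-side zero    _           = v₁
    v-side (suc j) (s<s j<m+1) with ℕₚ.m≤n⇒m<n∨m≡n (ℕₚ.≤-pred j<m+1)
    ... | inj₁ j<m  = vᵢ j j<m
    ... | inj₂ refl = vₖ
  ... | no r≮k = subst P k+q≡r (w-side (r ∸ k) q<k)
    where
    k+q≡r : k ℕ.+ (r ∸ k) ≡ r
    k+q≡r = ℕₚ.m+[n∸m]≡n (ℕₚ.≮⇒≥ r≮k)
    q<k : r ∸ k < k
    q<k = ℕₚ.+-cancelˡ-< k (r ∸ k) k (subst (_< n) (sym k+q≡r) r<n)
    w-side : ∀ q → q < k → P (k ℕ.+ q)
    w-side zero    _           = subst P (sym (ℕₚ.+-identityʳ k)) wₖ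
    w-side (suc q) (s<s q<m+1) with ℕₚ.m≤n⇒m<n∨m≡n (ℕₚ.≤-pred q<m+1)
    ... | inj₁ q<m  = subst P (sym (ℕₚ.+-suc k q))
                        (wᵢ q (m ∸ suc q) (trans (ℕₚ.+-suc q (m ∸ suc q)) (ℕₚ.m+[n∸m]≡n q<m)))
    ... | inj₂ refl = subst P (sym (ℕₚ.+-suc k q)) w₁

  split⇒< : ∀ {q e} → q ℕ.+ suc e ≡ m → e < m
  split⇒< {q} {e} q+e+1≡m = subst (e <_) q+e+1≡m (ℕₚ.m≤n+m (suc e) q)

  cycleDiag : ℕ → ℕ
  cycleDiag r = if cycIndex k r ≡ᵇ k then 3 else 2

  diag-inner : ∀ {r} e → cycIndex k r ≡ suc e → e ≢ suc m → cycleDiag r ≡ 2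
  diag-inner e index≡ e≢m+1 =
    trans (cong (λ i → if i ≡ᵇ k then 3 else 2) index≡)
          (cong (if_then 3 else 2) (≢⇒≡ᵇ-false e (suc m) e≢m+1))

  diag-end : ∀ {r} → cycIndex k r ≡ k → cycleDiag r ≡ 3
  diag-end index≡ =
    trans (cong (λ i → if i ≡ᵇ k then 3 else 2) index≡) (cong (if_then 3 else 2) (≡ᵇ-refl k))

  cycleRow : ℤ → (ℕ → ℤ) → ℕ → ℤ
  cycleRow h w r = + cycleDiag r * w r - (w (cycSucc n r) + w (cycPred n r)) - h

  module Rows (h : ℤ) (V W : ℕ → ℤ) where

    w : ℕ → ℤ
    w = byIndex k V W

    row-v₁ : cycleRow h w 0 ≡ + 2 * V 1 - (V 2 + W 1) - h
    row-v₁ = cong (λ z → + 2 * V 1 - (V 2 + z) - h)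
      (trans (cong w (trans n∸1≡last (sym (ℕₚ.+-suc k m))))
             (byIndex-w k (suc m) 0 V W refl (cong suc (ℕₚ.+-comm m 1))))

    row-vᵢ : ∀ j → j < m →
             cycleRow h w (suc j) ≡ + 2 * V (suc (suc j)) - (V (suc (suc (suc j))) + V (suc j)) - h
    row-vᵢ j j<m = row-cong
      (diag-inner {suc j} (suc j) (cycIndex-v j+1<k) (ℕₚ.<⇒≢ (s<s j<m)))
      (byIndex-v V W j+1<k)
      (trans (cong w (cycSucc-inner (<k⇒<n j+2<k))) (byIndex-v V W j+2<k))
      (byIndex-v V W (ℕₚ.<-trans (ℕₚ.n<1+n j) j+1<k))
      where
      j+2<k : suc (suc j) < k
      j+2<k = s<s (s<s j<m)
      j+1<k : suc j < k
      j+1<k = ℕₚ.<-trans (ℕₚ.n<1+n (suc j)) j+2<k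

    row-vₖ : cycleRow h w (suc m) ≡ + 3 * V k - (W k + V (suc m)) - h
    row-vₖ = row-cong
      (diag-end {suc m} (cycIndex-v (ℕₚ.n<1+n (suc m))))
      (byIndex-v V W (ℕₚ.n<1+n (suc m)))
      (trans (cong w (cycSucc-inner (ℕₚ.m<m+n k z<s))) (byIndex-w k 0 (suc m) V W (sym (ℕₚ.+-identityʳ k)) refl))
      (byIndex-v V W (ℕₚ.<-trans (ℕₚ.n<1+n m) (ℕₚ.n<1+n (suc m))))

    row-wₖ : cycleRow h w k ≡ + 3 * W k - (W (suc m) + V k) - h
    row-wₖ = row-cong
      (diag-end {k} (cycIndex-w k 0 (suc m) (sym (ℕₚ.+-identityʳ k)) refl))
      (byIndex-w k 0 (suc m) V W (sym (ℕₚ.+-identityʳ k)) refl)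
      (trans (cong w (cycSucc-inner (+2<n (ℕₚ.m≤m+n k m)))) (byIndex-w k 1 m V W (ℕₚ.+-comm 1 k) refl))
      (byIndex-v V W (ℕₚ.n<1+n (suc m)))

    row-wᵢ : ∀ q e → q ℕ.+ suc e ≡ m →
             cycleRow h w (suc (k ℕ.+ q)) ≡ + 2 * W (suc (suc e)) - (W (suc e) + W (suc (suc (suc e)))) - h
    row-wᵢ q e q+e+1≡m = row-cong
      (diag-inner {suc (k ℕ.+ q)} (suc e) (cycIndex-w k (suc q) (suc e) here index)
                  (ℕₚ.<⇒≢ (s<s (split⇒< q+e+1≡m))))
      (byIndex-w k (suc q) (suc e) V W here index)
      (trans (cong w (cycSucc-inner (+2<n (ℕₚ.+-monoʳ-< k q<m))))
             (byIndex-w k (suc (suc q)) e V W (trans (cong suc (sym (ℕₚ.+-suc k q))) (sym (ℕₚ.+-suc k (suc q))))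
                        (cong (suc ∘ suc) q+e+1≡m)))
      (byIndex-w k q (suc (suc e)) V W refl (trans (ℕₚ.+-suc q _) (cong suc index′)))
      where
      here : suc (k ℕ.+ q) ≡ k ℕ.+ suc q
      here = sym (ℕₚ.+-suc k q)
      index′ : q ℕ.+ suc (suc e) ≡ suc m
      index′ = trans (ℕₚ.+-suc q (suc e)) (cong suc q+e+1≡m)
      index : suc q ℕ.+ suc (suc e) ≡ k
      index = cong suc index′
      q<m : q < m
      q<m = subst (q <_) q+e+1≡m (ℕₚ.m<m+n q z<s)

    row-w₁ : cycleRow h w last ≡ + 2 * W 1 - (V 1 + W 2) - h
    row-w₁ = row-cong
      (diag-inner {last} 0 (cycIndex-w k (suc m) 0 here index) (λ ()))
      (byIndex-w k (suc m) 0 V W here index)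
      (cong w (cong (if_then 0 else suc last) (≡⇒≡ᵇ-true last+1≡n)))
      (byIndex-w k m 1 V W refl (ℕₚ.+-comm m 2))
      where
      here : last ≡ k ℕ.+ suc m
      here = sym (ℕₚ.+-suc k m)
      index : suc m ℕ.+ 1 ≡ k
      index = cong suc (ℕₚ.+-comm m 1)

    rows : (T : ℕ → ℤ) →
      + 2 * V 1 - (V 2 + W 1) - h ≡ T 0 →
      (∀ j → j < m → + 2 * V (suc (suc j)) - (V (suc (suc (suc j))) + V (suc j)) - h ≡ T (suc j)) →
      + 3 * V k - (W k + V (suc m)) - h ≡ T (suc m) →
      + 3 * W k - (W (suc m) + V k) - h ≡ T k →
      (∀ q e → q ℕ.+ suc e ≡ m →
         + 2 * W (suc (suc e)) - (W (suc e) + W (suc (suc (suc e)))) - h ≡ T (suc (k ℕ.+ q))) →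
      + 2 * W 1 - (V 1 + W 2) - h ≡ T last →
      ∀ i → (M · wheelVec h w) (fsuc i) ≡ T (toℕ i)
    rows T v₁ vᵢ vₖ wₖ wᵢ w₁ i =
      trans (cycle-row h w i)
        (by-region (λ r → cycleRow h w r ≡ T r)
          (trans row-v₁ v₁) (λ j j<m → trans (row-vᵢ j j<m) (vᵢ j j<m)) (trans row-vₖ vₖ)
          (trans row-wₖ wₖ) (λ q e q+e+1≡m → trans (row-wᵢ q e q+e+1≡m) (wᵢ q e q+e+1≡m))
          (trans row-w₁ w₁) (toℕ i) (Finₚ.toℕ<n i))

  s : ℕ → ℤ
  s i = + sIdx k i

  s-step : ∀ i → i ≤ k → s i ≡ + i + s (suc i)
  s-step i i≤k = trans (cong +_ (sIdx-step k i i≤k)) (ℤₚ.pos-+ i (sIdx k (suc i)))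

  s-k : s k ≡ K
  s-k = trans (s-step k ℕₚ.≤-refl) (trans (cong (λ t → K + + t) (sIdx-beyond k)) (ℤₚ.+-identityʳ K))

  s-k-1 : s (suc m) ≡ + suc m + K
  s-k-1 = trans (s-step (suc m) (ℕₚ.n≤1+n (suc m))) (cong (_+_ (+ suc m)) s-k)

  s-1 : s 1 ≡ + 1 + s 2
  s-1 = s-step 1 (s≤s z≤n)

  s-inner : ∀ i → suc (suc i) ≤ k → s (suc i) ≡ + suc i + (+ suc (suc i) + s (suc (suc (suc i))))
  s-inner i i+2≤k =
    trans (s-step (suc i) (ℕₚ.<⇒≤ i+2≤k)) (cong (_+_ (+ suc i)) (s-step (suc (suc i)) i+2≤k))

  Tₖ : ℤ
  Tₖ = sumTo (λ q → + q) k

  R : Vec' (suc n)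
  R i = + RW k i

  R-wheel : ∀ i → R i ≡ wheelVec (+ 1) (byIndex k s s) i
  R-wheel fzero    = refl
  R-wheel (fsuc p) = sym (byIndex-same k s (toℕ p))

  R-hub : + aHub k * + 1 - sumTo (byIndex k s s) n ≡ + 0
  R-hub = trans (cong₂ (λ a S → a * + 1 - S) (aHub-sum k) (sumTo-byIndex k s s))
                (double (sumTo (s ∘ suc) k))
    where
    double : ∀ S → + 2 * S * + 1 - (S + S) ≡ + 0
    double = solve-∀

  R-cycle : ∀ i → (M · wheelVec (+ 1) (byIndex k s s)) (fsuc i) ≡ + 0
  R-cycle = rows (λ _ → + 0)
    (trans (cong (λ x → + 2 * x - (s 2 + x) - + 1) s-1) (end-row (s 2)))
    (λ j j<m → trans (cong₂ (λ x y → + 2 * x - (s (3 ℕ.+ j) + y) - + 1)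
                             (s-step (suc (suc j)) (s≤s (s≤s (ℕₚ.<⇒≤ j<m))))
                             (s-inner j (s≤s (s≤s (ℕₚ.<⇒≤ j<m)))))
                      (inner-row (+ j) (s (3 ℕ.+ j))))
    (trans (cong₂ (λ x y → + 3 * x - (x + y) - + 1) s-k s-k-1) (corner-row (+ m)))
    (trans (cong₂ (λ x y → + 3 * x - (y + x) - + 1) s-k s-k-1) (corner-row′ (+ m)))
    (λ q e q+e+1≡m →
      let e+2≤k = s≤s (s≤s (ℕₚ.<⇒≤ (split⇒< q+e+1≡m))) in
      trans (cong₂ (λ x y → + 2 * x - (y + s (3 ℕ.+ e)) - + 1)
                    (s-step (suc (suc e)) e+2≤k) (s-inner e e+2≤k))
            (inner-row′ (+ e) (s (3 ℕ.+ e))))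
    (trans (cong (λ x → + 2 * x - (x + s 2) - + 1) s-1) (end-row′ (s 2)))
    where
    open Rows (+ 1) s s
    end-row : ∀ S → + 2 * (+ 1 + S) - (S + (+ 1 + S)) - + 1 ≡ + 0
    end-row = solve-∀
    end-row′ : ∀ S → + 2 * (+ 1 + S) - ((+ 1 + S) + S) - + 1 ≡ + 0
    end-row′ = solve-∀
    inner-row : ∀ I S → + 2 * ((+ 2 + I) + S) - (S + ((+ 1 + I) + ((+ 2 + I) + S))) - + 1 ≡ + 0
    inner-row = solve-∀
    inner-row′ : ∀ I S → + 2 * ((+ 2 + I) + S) - (((+ 1 + I) + ((+ 2 + I) + S)) + S) - + 1 ≡ + 0
    inner-row′ = solve-∀
    corner-row : ∀ M → let K = + 2 + M in + 3 * K - (K + ((+ 1 + M) + K)) - + 1 ≡ + 0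
    corner-row = solve-∀
    corner-row′ : ∀ M → let K = + 2 + M in + 3 * K - (((+ 1 + M) + K) + K) - + 1 ≡ + 0
    corner-row′ = solve-∀

  M·R≡0 : ∀ i → (M · R) i ≡ + 0
  M·R≡0 i = trans (sumFin-cong {suc n} (λ j → cong (M i j *_) (R-wheel j))) (kernel i)
    where
    kernel : ∀ i → (M · wheelVec (+ 1) (byIndex k s s)) i ≡ + 0
    kernel fzero    = trans (hub-row (+ 1) (byIndex k s s)) R-hub
    kernel (fsuc i) = R-cycle i

  V′ : ℕ → ℤ
  V′ i = K + + 1 - + i

  c′ : Vec' (suc n)
  c′ = wheelVec (+ 0) (byIndex k V′ V′)

  ends : ℕ → ℤ
  ends r = 𝟙 (r ≡ᵇ 0) + 𝟙 (r ≡ᵇ last)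

  ends-inner : ∀ {x} → x < k ℕ.+ m → + 0 ≡ ends (suc x)
  ends-inner {x} x<k+m = cong (λ b → + 0 + 𝟙 b) (sym (≢⇒≡ᵇ-false x (k ℕ.+ m) (ℕₚ.<⇒≢ x<k+m)))

  sum-c′ : sumTo (byIndex k V′ V′) n ≡ + 2 * s 1
  sum-c′ = begin
    sumTo (byIndex k V′ V′) n
      ≡⟨ trans (sumTo-byIndex k V′ V′) (cong₂ _+_ sum-V′ sum-V′) ⟩
    (K * K + Tₖ * - + 1) + (K * K + Tₖ * - + 1)
      ≡⟨ expand K Tₖ ⟩
    + 2 * K * K - + 2 * Tₖ
      ≡⟨ cong (λ t → + 2 * K * K - t) (sumTo-id k) ⟩
    + 2 * K * K - K * (K - + 1)
      ≡⟨ collect K ⟩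
    K * (K + + 1)
      ≡⟨ sIdx-first k ⟨
    + 2 * s 1 ∎
    where
    affine : ∀ K q → K + + 1 - (+ 1 + q) ≡ K + q * - + 1
    affine = solve-∀
    sum-V′ : sumTo (V′ ∘ suc) k ≡ K * K + Tₖ * - + 1
    sum-V′ = trans (sumTo-cong k (λ q _ → affine K (+ q))) (sumTo-affine k K (- + 1))
    expand : ∀ K T → (K * K + T * - + 1) + (K * K + T * - + 1) ≡ + 2 * K * K - + 2 * T
    expand = solve-∀
    collect : ∀ K → + 2 * K * K - K * (K - + 1) ≡ K * (K + + 1)
    collect = solve-∀

  M·c′-cycle : ∀ i → (M · c′) (fsuc i) ≡ ends (toℕ i)
  M·c′-cycle = rows ends
    (end-row K)
    (λ j j<m → trans (inner-row K (+ j)) (ends-inner (ℕₚ.<-≤-trans j<m (ℕₚ.m≤n+m m k))))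
    (trans (corner-row (+ m)) (ends-inner (ℕₚ.m<n+m m {k} z<s)))
    (trans (corner-row′ (+ m)) (ends-inner (ℕₚ.m≤m+n k m)))
    (λ q e q+e+1≡m → trans (inner-row′ K (+ e))
                           (ends-inner (ℕₚ.+-monoʳ-< k (subst (q <_) q+e+1≡m (ℕₚ.m<m+n q z<s)))))
    (trans (end-row′ K) (cong (λ b → + 0 + 𝟙 b) (sym (≡ᵇ-refl last))))
    where
    open Rows (+ 0) V′ V′
    end-row : ∀ K → + 2 * (K + + 1 - + 1) - ((K + + 1 - + 2) + (K + + 1 - + 1)) - + 0 ≡ + 1
    end-row = solve-∀
    end-row′ : ∀ K → + 2 * (K + + 1 - + 1) - ((K + + 1 - + 1) + (K + + 1 - + 2)) - + 0 ≡ + 1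
    end-row′ = solve-∀
    inner-row : ∀ K I → + 2 * (K + + 1 - (+ 2 + I)) - ((K + + 1 - (+ 3 + I)) + (K + + 1 - (+ 1 + I))) - + 0 ≡ + 0
    inner-row = solve-∀
    inner-row′ : ∀ K I → + 2 * (K + + 1 - (+ 2 + I)) - ((K + + 1 - (+ 1 + I)) + (K + + 1 - (+ 3 + I))) - + 0 ≡ + 0
    inner-row′ = solve-∀
    corner-row : ∀ M → let K = + 2 + M in + 3 * (K + + 1 - K) - ((K + + 1 - K) + (K + + 1 - (+ 1 + M))) - + 0 ≡ + 0
    corner-row = solve-∀
    corner-row′ : ∀ M → let K = + 2 + M in + 3 * (K + + 1 - K) - ((K + + 1 - (+ 1 + M)) + (K + + 1 - K)) - + 0 ≡ + 0
    corner-row′ = solve-∀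

  M·c′ : ∀ i → (M · c′) i ≡ wheelVec (- (+ 2 * s 1)) ends i
  M·c′ fzero    = begin
    (M · c′) fzero                              ≡⟨ hub-row (+ 0) (byIndex k V′ V′) ⟩
    + aHub k * + 0 - sumTo (byIndex k V′ V′) n  ≡⟨ vanish (+ aHub k) _ ⟩
    - sumTo (byIndex k V′ V′) n                 ≡⟨ cong -_ sum-c′ ⟩
    - (+ 2 * s 1)                               ∎
    where
    vanish : ∀ a X → a * + 0 - X ≡ - X
    vanish = solve-∀
  M·c′ (fsuc i) = M·c′-cycle i

  last∈span : Spanned (cycleVec (n ∸ 1))
  last∈span = - + 1 , + 2 * s 1 , c′ , λ i → trans (sym (entry i)) (sym (M·c′ i))
    where
    entry : ∀ i → wheelVec (- (+ 2 * s 1)) ends i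
                  ≡ cycleVec (n ∸ 1) i - (- + 1 * cycleVec 0 i + + 2 * s 1 * hubVec i)
    entry fzero    = rearrange (s 1)
      where
      rearrange : ∀ S → - (+ 2 * S) ≡ + 0 - (- + 1 * + 0 + + 2 * S * + 1)
      rearrange = solve-∀
    entry (fsuc i) =
      trans (rearrange (𝟙 (toℕ i ≡ᵇ 0)) (𝟙 (toℕ i ≡ᵇ last)) (s 1))
            (cong (λ l → 𝟙 (toℕ i ≡ᵇ l) - (- + 1 * 𝟙 (toℕ i ≡ᵇ 0) + + 2 * s 1 * + 0)) (sym n∸1≡last))
      where
      rearrange : ∀ x y S → x + y ≡ y - (- + 1 * x + + 2 * S * + 0)
      rearrange = solve-∀

  N : ℕ
  N = 6 ℕ.* k ∸ 1

  N≡6K-1 : + N ≡ + 6 * K - + 1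
  N≡6K-1 = begin
    + (6 ℕ.* (2 ℕ.+ m) ∸ 1)  ≡⟨ cong (λ x → + (x ∸ 1)) (ℕₚ.*-distribˡ-+ 6 2 m) ⟩
    + (11 ℕ.+ 6 ℕ.* m)       ≡⟨ ℤₚ.pos-+ 11 (6 ℕ.* m) ⟩
    + 11 + + (6 ℕ.* m)       ≡⟨ cong (_+_ (+ 11)) (ℤₚ.pos-* 6 m) ⟩
    + 11 + + 6 * + m         ≡⟨ affine (+ m) ⟩
    + 6 * K - + 1            ∎
    where
    affine : ∀ M → + 11 + + 6 * M ≡ + 6 * (+ 2 + M) - + 1
    affine = solve-∀

  -- The solution c of M c = N (e_{v₁} - s₁ e_u): its entries are affine in i along each
  -- half of the cycle, since the rows at the inner cycle vertices are second differences.
  A₀ D₁ B₀ D₂ : ℤ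
  A₀ = + 3 * K * K + K - + 1
  D₁ = - (+ 3 * K + + 1)
  B₀ = + 3 * K - + 1
  D₂ = + 3 * K - + 2

  Vc Wc : ℕ → ℤ
  Vc i = A₀ + (+ i - + 1) * D₁
  Wc i = B₀ + (K - + i) * D₂

  c : Vec' (suc n)
  c = wheelVec (+ 0) (byIndex k Vc Wc)

  g : Vec' (suc n)
  g = wheelVec (- s 1) (λ r → 𝟙 (r ≡ᵇ 0))

  g≡X-s₁H : ∀ i → g i ≡ cycleVec 0 i - s 1 * hubVec i
  g≡X-s₁H fzero    = rearrange (s 1)
    where
    rearrange : ∀ S → - S ≡ + 0 - S * + 1
    rearrange = solve-∀
  g≡X-s₁H (fsuc i) = rearrange (s 1) (𝟙 (toℕ i ≡ᵇ 0))
    where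
    rearrange : ∀ S x → x ≡ x - S * + 0
    rearrange = solve-∀

  sum-Vc : sumTo (Vc ∘ suc) k ≡ K * A₀ + Tₖ * D₁
  sum-Vc = trans (sumTo-cong k (λ q _ → shift A₀ D₁ (+ q))) (sumTo-affine k A₀ D₁)
    where
    shift : ∀ A D q → A + ((+ 1 + q) - + 1) * D ≡ A + q * D
    shift = solve-∀

  sum-Wc : sumTo (Wc ∘ suc) k ≡ K * (B₀ + (K - + 1) * D₂) + Tₖ * - D₂
  sum-Wc = trans (sumTo-cong k (λ q _ → shift B₀ K D₂ (+ q)))
                 (sumTo-affine k (B₀ + (K - + 1) * D₂) (- D₂))
    where
    shift : ∀ B K D q → B + (K - (+ 1 + q)) * D ≡ (B + (K - + 1) * D) + q * - D
    shift = solve-∀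

  sum-c : sumTo (byIndex k Vc Wc) n ≡ + N * s 1
  sum-c = ℤₚ.*-cancelˡ-≡ (+ 2) _ _ (begin
    + 2 * sumTo (byIndex k Vc Wc) n
      ≡⟨ cong (+ 2 *_) (trans (sumTo-byIndex k Vc Wc) (cong₂ _+_ sum-Vc sum-Wc)) ⟩
    + 2 * ((K * A₀ + Tₖ * D₁) + (K * (B₀ + (K - + 1) * D₂) + Tₖ * - D₂))
      ≡⟨ expand K Tₖ ⟩
    + 2 * K * (A₀ + (B₀ + (K - + 1) * D₂)) + (+ 2 * Tₖ) * (D₁ - D₂)
      ≡⟨ cong (λ t → + 2 * K * (A₀ + (B₀ + (K - + 1) * D₂)) + t * (D₁ - D₂)) (sumTo-id k) ⟩
    + 2 * K * (A₀ + (B₀ + (K - + 1) * D₂)) + K * (K - + 1) * (D₁ - D₂)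
      ≡⟨ collect K ⟩
    (+ 6 * K - + 1) * (K * (K + + 1))
      ≡⟨ cong₂ _*_ N≡6K-1 (sIdx-first k) ⟨
    + N * (+ 2 * s 1)
      ≡⟨ swap (+ N) (s 1) ⟩
    + 2 * (+ N * s 1) ∎)
    where
    expand : ∀ K T → let A = + 3 * K * K + K - + 1; D = - (+ 3 * K + + 1)
                         B = + 3 * K - + 1; E = + 3 * K - + 2 in
      + 2 * ((K * A + T * D) + (K * (B + (K - + 1) * E) + T * - E))
        ≡ + 2 * K * (A + (B + (K - + 1) * E)) + (+ 2 * T) * (D - E)
    expand = solve-∀
    collect : ∀ K → let A = + 3 * K * K + K - + 1; D = - (+ 3 * K + + 1)
                        B = + 3 * K - + 1; E = + 3 * K - + 2 in
      + 2 * K * (A + (B + (K - + 1) * E)) + K * (K - + 1) * (D - E) ≡ (+ 6 * K - + 1) * (K * (K + + 1))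
    collect = solve-∀
    swap : ∀ x y → x * (+ 2 * y) ≡ + 2 * (x * y)
    swap = solve-∀

  M·c-cycle : ∀ i → (M · c) (fsuc i) ≡ + N * 𝟙 (toℕ i ≡ᵇ 0)
  M·c-cycle = rows (λ r → + N * 𝟙 (r ≡ᵇ 0))
    (trans (end-row K) (cong (_* + 1) (sym N≡6K-1)))
    (λ j _ → trans (inner-row A₀ D₁ (+ j)) 0≡N*0)
    (trans (corner-row (+ m)) 0≡N*0)
    (trans (corner-row′ (+ m)) 0≡N*0)
    (λ _ e _ → trans (inner-row′ B₀ K D₂ (+ e)) 0≡N*0)
    (trans (end-row′ K) 0≡N*0)
    where
    open Rows (+ 0) Vc Wc
    0≡N*0 : + 0 ≡ + N * + 0
    0≡N*0 = sym (ℤₚ.*-zeroʳ (+ N))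
    inner-row : ∀ A D J → + 2 * (A + ((+ 2 + J) - + 1) * D)
                            - ((A + ((+ 3 + J) - + 1) * D) + (A + ((+ 1 + J) - + 1) * D)) - + 0 ≡ + 0
    inner-row = solve-∀
    inner-row′ : ∀ B K D E → + 2 * (B + (K - (+ 2 + E)) * D)
                               - ((B + (K - (+ 1 + E)) * D) + (B + (K - (+ 3 + E)) * D)) - + 0 ≡ + 0
    inner-row′ = solve-∀
    end-row : ∀ K → let A = + 3 * K * K + K - + 1; D = - (+ 3 * K + + 1)
                        B = + 3 * K - + 1; E = + 3 * K - + 2 in
      + 2 * (A + (+ 1 - + 1) * D) - ((A + (+ 2 - + 1) * D) + (B + (K - + 1) * E)) - + 0 ≡ (+ 6 * K - + 1) * + 1
    end-row = solve-∀
    end-row′ : ∀ K → let A = + 3 * K * K + K - + 1; D = - (+ 3 * K + + 1)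
                         B = + 3 * K - + 1; E = + 3 * K - + 2 in
      + 2 * (B + (K - + 1) * E) - ((A + (+ 1 - + 1) * D) + (B + (K - + 2) * E)) - + 0 ≡ + 0
    end-row′ = solve-∀
    corner-row : ∀ M → let K = + 2 + M; A = + 3 * K * K + K - + 1; D = - (+ 3 * K + + 1)
                           B = + 3 * K - + 1; E = + 3 * K - + 2 in
      + 3 * (A + (K - + 1) * D) - ((B + (K - K) * E) + (A + ((+ 1 + M) - + 1) * D)) - + 0 ≡ + 0
    corner-row = solve-∀
    corner-row′ : ∀ M → let K = + 2 + M; A = + 3 * K * K + K - + 1; D = - (+ 3 * K + + 1)
                            B = + 3 * K - + 1; E = + 3 * K - + 2 in
      + 3 * (B + (K - K) * E) - ((B + (K - (+ 1 + M)) * E) + (A + (K - + 1) * D)) - + 0 ≡ + 0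
    corner-row′ = solve-∀

  M·c-hub : (M · c) fzero ≡ + N * - s 1
  M·c-hub = begin
    (M · c) fzero                                ≡⟨ hub-row (+ 0) (byIndex k Vc Wc) ⟩
    + aHub k * + 0 - sumTo (byIndex k Vc Wc) n   ≡⟨ vanish (+ aHub k) _ ⟩
    - sumTo (byIndex k Vc Wc) n                  ≡⟨ cong -_ sum-c ⟩
    - (+ N * s 1)                                ≡⟨ ℤₚ.neg-distribʳ-* (+ N) (s 1) ⟩
    + N * - s 1                                  ∎
    where
    vanish : ∀ a X → a * + 0 - X ≡ - X
    vanish = solve-∀

  Mc≡Ng : ∀ i → (M · c) i ≡ + N * g i
  Mc≡Ng fzero    = M·c-hub
  Mc≡Ng (fsuc i) = M·c-cycle i

  c·g≡A₀ : dot c g ≡ A₀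
  c·g≡A₀ = begin
    dot c g
      ≡⟨ dot-wheelVec {n} (+ 0) (- s 1) (byIndex k Vc Wc) (λ r → 𝟙 (r ≡ᵇ 0)) ⟩
    + 0 * - s 1 + sumTo (λ r → byIndex k Vc Wc r * 𝟙 (r ≡ᵇ 0)) n
      ≡⟨ cong (_+_ (+ 0 * - s 1)) (sumTo-indicatorʳ n 0 (byIndex k Vc Wc) z<s) ⟩
    + 0 * - s 1 + (A₀ + (+ 1 - + 1) * D₁)
      ≡⟨ simplify (- s 1) A₀ D₁ ⟩
    A₀ ∎
    where
    simplify : ∀ S A D → + 0 * S + (A + (+ 1 - + 1) * D) ≡ A
    simplify = solve-∀

  bézout : - (+ 8 * K) * dot c g + (+ 4 * K * K + + 2 * K - + 1) * + N ≡ + 1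
  bézout =
    trans (cong₂ (λ x y → - (+ 8 * K) * x + (+ 4 * K * K + + 2 * K - + 1) * y) c·g≡A₀ N≡6K-1)
          (identity K)
    where
    identity : ∀ K → - (+ 8 * K) * (+ 3 * K * K + K - + 1)
                       + (+ 4 * K * K + + 2 * K - + 1) * (+ 6 * K - + 1) ≡ + 1
    identity = solve-∀

  R·v : ∀ v → dot R v ≡ dot (wheelVec (+ 1) (byIndex k s s)) v
  R·v v = sumFin-cong {suc n} (λ i → cong (_* v i) (R-wheel i))

  R·X≡s₁ : dot R (cycleVec 0) ≡ s 1
  R·X≡s₁ = begin
    dot R (cycleVec 0)
      ≡⟨ trans (R·v (cycleVec 0)) (dot-wheelVec {n} (+ 1) (+ 0) (byIndex k s s) (λ r → 𝟙 (r ≡ᵇ 0))) ⟩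
    + 1 * + 0 + sumTo (λ r → byIndex k s s r * 𝟙 (r ≡ᵇ 0)) n
      ≡⟨ cong (_+_ (+ 1 * + 0)) (sumTo-indicatorʳ n 0 (byIndex k s s) z<s) ⟩
    + 0 + s 1
      ≡⟨ ℤₚ.+-identityˡ (s 1) ⟩
    s 1 ∎

  R·H≡1 : dot R hubVec ≡ + 1
  R·H≡1 = begin
    dot R hubVec
      ≡⟨ trans (R·v hubVec) (dot-wheelVec {n} (+ 1) (+ 1) (byIndex k s s) (λ _ → + 0)) ⟩
    + 1 * + 1 + sumTo (λ r → byIndex k s s r * + 0) n
      ≡⟨ cong (_+_ (+ 1)) (sumTo-zero n _ (λ r _ → ℤₚ.*-zeroʳ (byIndex k s s r))) ⟩
    + 1 ∎

  diag≥1 : ∀ i → 1 ≤ diagW k i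
  diag≥1 fzero    = s≤s z≤n
  diag≥1 (fsuc p) with cycIndex k (toℕ p) ≡ᵇ k
  ... | true  = s≤s z≤n
  ... | false = s≤s z≤n

  R-pos : ∀ i → 0 < RW k i
  R-pos fzero    = z<s
  R-pos (fsuc p) = sIdx-pos k _ (proj₁ index-range) (proj₂ index-range)
    where
    index-range = cycIndex-range {k} (Finₚ.toℕ<n p)

  arithmetical : IsArithmeticalStructure (wheelAdj n) (MW k) (RW k)
  arithmetical =
    (diagW k , diag≥1 , λ _ _ → refl) , R-pos , gcd-zeroˡ (gcdVec (RW k ∘ fsuc)) , M·R≡0

  Φ-cyclic : PhiCyclicOfOrder (MW k) N
  Φ-cyclic = cyclic-criterion {R = R} {X = cycleVec 0} {H = hubVec} {g = g} {c = c}
                              {u = - (+ 8 * K)} {v = + 4 * K * K + + 2 * K - + 1} {N = N} M·R≡0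
                              R·X≡s₁ R·H≡1 g≡X-s₁H (spanned last∈span) Mc≡Ng bézout (s≤s z≤n)
    where
    open Cyclicity M-sym

lemma3p10 : (k : ℕ) → 2 ≤ k →
    IsArithmeticalStructure (wheelAdj (k ℕ.+ k)) (MW k) (RW k)
    × PhiCyclicOfOrder (MW k) (6 ℕ.* k ∸ 1)
lemma3p10 (suc (suc m)) (s≤s (s≤s z≤n)) = arithmetical , Φ-cyclic
  where
  open Wheel2k m
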